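{- Let $q$ be a prime power, and $m,n,\delta$ positive integers with $m\geq n\geq\delta$; let $k=n-\delta+1$ and assume $m\geq kn-k^2+2$. Let $\beta\in\mathbb F_{q^m}$ be such that $(1,\beta,\beta^2,\dots,\beta^{m-1})$ is a basis of $\mathbb F_{q^m}$ over $\mathbb F_q$. Let $\mathbf G$ be a $k\times n$ matrix over $\mathbb F_{q^m}$ (rows indexed $1,\dots,k$, columns $0,\dots,n-1$) with: $\mathbf G_{i,j}=1$ if $j=i-1$ and $\mathbf G_{i,j}=0$ if $j\le k-1$, $j\ne i-1$; $\mathbf G_{i,j}=a_{i,j}\beta^{j-i+1}$ for $k\le j\le n-2$; $\mathbf G_{1,n-1}=a_{1,n-1}\beta^{n}$ and $\mathbf G_{i,n-1}=a_{i,n-1}\beta^{n-i}$ for $2\le i\le k$, where all $a_{i,j}\in\mathbb F_q^*$ ($1\le i\le k$, $k\le j\le n-1$). If every minor of $\mathbf A_1=(a_{i,j})_{1\le i\le k,\,k\le j\le n-2}$ and every minor of $\mathbf A_2=(a_{i,j})_{2\le i\le k,\,k\le j\le n-1}$ is nonzero, then $\mathbf G$ is a generator matrix of a systematic MRD$[m\times n,\delta]_q$ code.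
   Context: Fix an ordered basis $(\beta_0,\dots,\beta_{m-1})$ of $\mathbb F_{q^m}$ over $\mathbb F_q$; $\Psi_m:\mathbb F_{q^m}^n\to\mathbb F_q^{m\times n}$ sends $(a_0,\dots,a_{n-1})$ to the matrix $A$ with $a_j=\sum_i A_{i,j}\beta_i$, and the rank of a vector is the rank of its image (independent of the chosen basis). A $k\times n$ matrix $\mathbf G$ over $\mathbb F_{q^m}$ ($m\ge n$) of rank $k$ is a generator matrix of an MRD$[m\times n,\delta]_q$ code if $k=n-\delta+1$ and every nonzero vector $\mathbf u\mathbf G$ ($\mathbf u\in\mathbb F_{q^m}^k$) has rank at least $\delta$; it is systematic if it has the form $(\mathbf I_k\mid\mathbf A)$. -}

module Defs where

open import Level using (Level; _⊔_) renaming (suc to lsuc)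
open import Algebra.Bundles using (CommutativeRing)
open import Data.Nat as ℕ using (ℕ; zero; suc; _∸_; _≤_; _<?_; _≟_)
import Data.Nat
open import Data.Nat.Primality using (Prime)
open import Data.Fin as Fin using (Fin; toℕ; punchIn)
open import Data.Product using (Σ; ∃; ∃-syntax; _×_; _,_)
open import Data.Bool using (if_then_else_)
open import Relation.Nullary using (¬_; does)
open import Relation.Binary.PropositionalEquality using (_≡_)
open import Relation.Binary.Definitions using (Decidable)

record Field (c ℓ : Level) : Set (lsuc (c ⊔ ℓ)) where
  field
    commutativeRing : CommutativeRing c ℓ
  open CommutativeRing commutativeRing public
  field
    0≉1     : ¬ (0# ≈ 1#)
    inverse : ∀ x → ¬ (x ≈ 0#) → ∃[ y ] (x * y ≈ 1#)

module FieldOps {c ℓ} (F : Field c ℓ) where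
  open Field F

  sumF : ∀ n → (Fin n → Carrier) → Carrier
  sumF zero    f = 0#
  sumF (suc n) f = f Fin.zero + sumF n (λ i → f (Fin.suc i))

  pow : Carrier → ℕ → Carrier
  pow x zero    = 1#
  pow x (suc e) = x * pow x e

  alt : ℕ → Carrier → Carrier
  alt zero    x = x
  alt (suc e) x = - alt e x

  det : ∀ r → (Fin r → Fin r → Carrier) → Carrier
  det zero    M = 1#
  det (suc r) M =
    sumF (suc r) (λ j → alt (toℕ j) (M Fin.zero j * det r (λ s t → M (Fin.suc s) (punchIn j t))))

PrimePower : ℕ → Set
PrimePower q = ∃[ p ] ∃[ e ] (Prime p × 1 ≤ e × q ≡ p Data.Nat.^ e)

record FiniteField {c ℓ} (F : Field c ℓ) (q : ℕ) : Set (c ⊔ ℓ) where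
  open Field F
  field
    enum     : Fin q → Carrier
    enum-inj : ∀ i j → enum i ≈ enum j → i ≡ j
    enum-sur : ∀ x → ∃[ i ] (x ≈ enum i)
    _≈?_     : Decidable _≈_

record IsFieldHom {c ℓ c' ℓ'} (F : Field c ℓ) (K : Field c' ℓ')
                  (ι : Field.Carrier F → Field.Carrier K) : Set (c ⊔ ℓ ⊔ ℓ') where
  module F = Field F
  module K = Field K
  field
    ι-cong : ∀ {x y} → x F.≈ y → ι x K.≈ ι y
    ι-+    : ∀ x y → ι (x F.+ y) K.≈ ι x K.+ ι y
    ι-*    : ∀ x y → ι (x F.* y) K.≈ ι x K.* ι y
    ι-0    : ι F.0# K.≈ K.0#
    ι-1    : ι F.1# K.≈ K.1#

record PowerBasis {c ℓ c' ℓ'} (F : Field c ℓ) (K : Field c' ℓ')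
                  (ι : Field.Carrier F → Field.Carrier K)
                  (m : ℕ) (β : Field.Carrier K) : Set (c ⊔ ℓ ⊔ c' ⊔ ℓ') where
  module F = Field F
  module K = Field K
  open FieldOps K
  field
    coord  : K.Carrier → Fin m → F.Carrier
    expand : ∀ x → x K.≈ sumF m (λ i → ι (coord x i) K.* pow β (toℕ i))
    indep  : ∀ (cs : Fin m → F.Carrier) →
             sumF m (λ i → ι (cs i) K.* pow β (toℕ i)) K.≈ K.0# →
             ∀ i → cs i F.≈ F.0#

Ψ : ∀ {c ℓ c' ℓ'} {F : Field c ℓ} {K : Field c' ℓ'} {ι} {m β} →
    PowerBasis F K ι m β → ∀ {n} → (Fin n → Field.Carrier K) →
    Fin m → Fin n → Field.Carrier F
Ψ B a i j = PowerBasis.coord B (a j) i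

RankAtLeast : ∀ {c ℓ} (F : Field c ℓ) {m n : ℕ} →
              (Fin m → Fin n → Field.Carrier F) → ℕ → Set (c ⊔ ℓ)
RankAtLeast F {m} {n} A d =
  Σ (Fin d → Fin n) λ σ → ((∀ s t → σ s ≡ σ t → s ≡ t) ×
          (∀ (cs : Fin d → Carrier) →
             (∀ i → sumF d (λ t → cs t * A i (σ t)) ≈ 0#) →
             ∀ t → cs t ≈ 0#))
  where open Field F
        open FieldOps F

vecMat : ∀ {c ℓ} (K : Field c ℓ) {k n} →
         (Fin k → Field.Carrier K) → (Fin k → Fin n → Field.Carrier K) →
         Fin n → Field.Carrier K
vecMat K {k} u G j = FieldOps.sumF K k (λ i → Field._*_ K (u i) (G i j))

record IsMRDGenerator {c ℓ c' ℓ'} {F : Field c ℓ} {K : Field c' ℓ'} {ι} {m β}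
                      (B : PowerBasis F K ι m β) (n δ k : ℕ)
                      (G : Fin k → Fin n → Field.Carrier K) : Set (c ⊔ ℓ ⊔ c' ⊔ ℓ') where
  module K = Field K
  field
    k≡ : k ≡ n ∸ δ ℕ.+ 1
    fullRank : ∀ (u : Fin k → K.Carrier) →
               (∀ j → vecMat K u G j K.≈ K.0#) → ∀ i → u i K.≈ K.0#
    minRank : ∀ (u : Fin k → K.Carrier) →
              ¬ (∀ j → vecMat K u G j K.≈ K.0#) →
              RankAtLeast F (Ψ B (vecMat K u G)) δ

IsSystematic : ∀ {c ℓ} (K : Field c ℓ) {k n} →
               (Fin k → Fin n → Field.Carrier K) → Set ℓ
IsSystematic K {k} G =
  (∀ i j → toℕ j ≡ toℕ i → G i j ≈ 1#) ×
  (∀ i j → toℕ j Data.Nat.< k → ¬ (toℕ j ≡ toℕ i) → G i j ≈ 0#)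
  where open Field K

kOf : ℕ → ℕ → ℕ
kOf n δ = n ∸ δ ℕ.+ 1

-- Entry G_{i,j} with the paper's indices (rows i = 1..k, columns j = 0..n-1);
-- a i j are the paper's a_{i,j}.
gEntry : ∀ {c ℓ c' ℓ'} (F : Field c ℓ) (K : Field c' ℓ')
         (ι : Field.Carrier F → Field.Carrier K) (β : Field.Carrier K)
         (n k : ℕ) (a : ℕ → ℕ → Field.Carrier F) → ℕ → ℕ → Field.Carrier K
gEntry F K ι β n k a i j =
  if does (j <? k)
  then (if does (j ≟ i ∸ 1) then 1# else 0#)
  else (if does (suc j <? n)
        then ι (a i j) * pow β (suc j ∸ i)
        else (if does (i ≟ 1)
              then ι (a i j) * pow β n
              else ι (a i j) * pow β (n ∸ i)))
  where open Field K
        open FieldOps K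

-- G as a k × n matrix: row r ↔ i = r + 1, column c ↔ j = c
gMatrix : ∀ {c ℓ c' ℓ'} (F : Field c ℓ) (K : Field c' ℓ')
          (ι : Field.Carrier F → Field.Carrier K) (β : Field.Carrier K)
          (n k : ℕ) (a : ℕ → ℕ → Field.Carrier F) → Fin k → Fin n → Field.Carrier K
gMatrix F K ι β n k a r col = gEntry F K ι β n k a (suc (toℕ r)) (toℕ col)

StrictMono : ∀ {r s} → (Fin r → Fin s) → Set
StrictMono σ = ∀ x y → x Fin.< y → σ x Fin.< σ y

A1MinorsNonzero : ∀ {c ℓ} (F : Field c ℓ) (n k : ℕ) → (ℕ → ℕ → Field.Carrier F) → Set ℓ
A1MinorsNonzero F n k a =
  ∀ r (ρ : Fin r → Fin k) (γ : Fin r → Fin (n ∸ 1 ∸ k)) → StrictMono ρ → StrictMono γ →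
  ¬ (det r (λ s t → a (suc (toℕ (ρ s))) (k ℕ.+ toℕ (γ t))) ≈ 0#)
  where open Field F
        open FieldOps F

A2MinorsNonzero : ∀ {c ℓ} (F : Field c ℓ) (n k : ℕ) → (ℕ → ℕ → Field.Carrier F) → Set ℓ
A2MinorsNonzero F n k a =
  ∀ r (ρ : Fin r → Fin (k ∸ 1)) (γ : Fin r → Fin (n ∸ k)) → StrictMono ρ → StrictMono γ →
  ¬ (det r (λ s t → a (2 ℕ.+ toℕ (ρ s)) (k ℕ.+ toℕ (γ t))) ≈ 0#)
  where open Field F
        open FieldOps F

-- Let u ≠ 0 and c = uG.  Call a position b redundant if c_b lies in the
-- F-span of c_0, …, c_{b-1}.  The columns of Ψ(c) at non-redundant positions
-- are F-independent, so δ such positions give rank Ψ(c) ≥ δ.  Otherwise there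
-- are k redundant positions τ_1 < … < τ_k, c_{τ_l} = Σ_{b<τ_l} x_{l,b} c_b, and
-- u lies in the left kernel of the k × k matrix
--   M_{s,l} = G_{s,τ_l} − Σ_{b<τ_l} x_{l,b} G_{s,b},
-- so det M = 0.  After multiplying row s by β^s, every entry of M is an
-- F-combination of the powers β^e with s ≤ e ≤ τ_l + 1 (e ≤ n + 1 for the
-- entry a_{1,n-1} β^n), and its coefficient at the top power comes from G_{s,τ_l}
-- alone.  Hence det M is an F-combination of a window of fewer than m powers
-- of β (this is where m ≥ k(n−k)+2 enters) whose top coefficient is a minor of
-- (I | A): after expanding the unit columns it is, up to sign, a minor of A_1
-- (when u_1 ≠ 0 and τ_k < n − 1), a_{1,n-1} times a minor of A_2 (when u_1 ≠ 0
-- and τ_k = n − 1), or a minor of A_2 (when u_1 = 0, using the rows 2, …, k and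
-- the positions τ_2, …, τ_k).  It is nonzero, contradicting the independence
-- of 1, β, …, β^{m-1}.

module Submission where

open import Defs
open import Level using (Level; _⊔_)
open import Data.Nat as ℕ using (ℕ; zero; suc; _∸_; z≤n; s≤s)
import Data.Nat.Properties as ℕ
import Algebra.Properties.CommutativeMonoid.Sum ℕ.+-0-commutativeMonoid as ℕSum
open import Data.Nat.Tactic.RingSolver using (solve-∀)
open import Data.Fin as Fin using (Fin; toℕ; punchIn; punchOut)
import Data.Fin.Properties as FinP
open import Data.Vec.Functional using (_∷_)
open import Data.Product using (Σ; ∃; _×_; _,_; proj₁; proj₂)
open import Data.Sum as Sum using (_⊎_; inj₁; inj₂)
open import Data.Empty using (⊥; ⊥-elim)
open import Data.Bool using (if_then_else_; true; false; T)
open import Data.Unit using (tt)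
open import Relation.Nullary using (¬_; Dec; yes; no; does)
open import Relation.Binary.Definitions using (Decidable; tri<; tri≈; tri>)
open import Relation.Binary.PropositionalEquality as P using (_≡_; _≢_; cong; cong₂)
open import Function using (_∘_)

punchInℕ : ℕ → ℕ → ℕ
punchInℕ zero    j       = suc j
punchInℕ (suc i) zero    = zero
punchInℕ (suc i) (suc j) = suc (punchInℕ i j)

punchOutℕ : ℕ → ℕ → ℕ
punchOutℕ zero    zero    = zero
punchOutℕ zero    (suc j) = j
punchOutℕ (suc i) zero    = zero
punchOutℕ (suc i) (suc j) = suc (punchOutℕ i j)

swapAdjℕ : ℕ → ℕ → ℕ
swapAdjℕ zero    zero          = 1
swapAdjℕ zero    (suc zero)    = 0
swapAdjℕ zero    (suc (suc x)) = suc (suc x)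
swapAdjℕ (suc p) zero          = zero
swapAdjℕ (suc p) (suc x)       = suc (swapAdjℕ p x)

toℕ-punchIn : ∀ {n} (i : Fin (suc n)) (j : Fin n) → toℕ (punchIn i j) ≡ punchInℕ (toℕ i) (toℕ j)
toℕ-punchIn Fin.zero        j           = P.refl
toℕ-punchIn (Fin.suc i) Fin.zero        = P.refl
toℕ-punchIn (Fin.suc i) (Fin.suc j) = cong suc (toℕ-punchIn i j)

toℕ-punchOut : ∀ {n} {i j : Fin (suc n)} (i≢j : i ≢ j) → toℕ (punchOut i≢j) ≡ punchOutℕ (toℕ i) (toℕ j)
toℕ-punchOut {_}     {Fin.zero}  {Fin.zero}  i≢j = ⊥-elim (i≢j P.refl)
toℕ-punchOut {_}     {Fin.zero}  {Fin.suc j} i≢j = P.refl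
toℕ-punchOut {suc n} {Fin.suc i} {Fin.zero}  i≢j = P.refl
toℕ-punchOut {suc n} {Fin.suc i} {Fin.suc j} i≢j = cong suc (toℕ-punchOut (i≢j ∘ cong Fin.suc))

punchInℕ-self : ∀ p → punchInℕ p p ≡ suc p
punchInℕ-self zero    = P.refl
punchInℕ-self (suc p) = cong suc (punchInℕ-self p)

punchInℕ-suc-self : ∀ p → punchInℕ (suc p) p ≡ p
punchInℕ-suc-self zero    = P.refl
punchInℕ-suc-self (suc p) = cong suc (punchInℕ-suc-self p)

punchInℕ-below : ∀ i x → x ℕ.< i → punchInℕ i x ≡ x
punchInℕ-below (suc i) zero    _         = P.refl
punchInℕ-below (suc i) (suc x) (s≤s x<i) = cong suc (punchInℕ-below i x x<i)

punchInℕ-mono-< : ∀ i x y → x ℕ.< y → punchInℕ i x ℕ.< punchInℕ i y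
punchInℕ-mono-< zero    x       y       x<y       = s≤s x<y
punchInℕ-mono-< (suc i) zero    (suc y) _         = s≤s z≤n
punchInℕ-mono-< (suc i) (suc x) (suc y) (s≤s x<y) = s≤s (punchInℕ-mono-< i x y x<y)

punchInℕ-suc-pivot : ∀ p x → x ≢ p → punchInℕ p x ≡ punchInℕ (suc p) x
punchInℕ-suc-pivot zero    zero    x≢p = ⊥-elim (x≢p P.refl)
punchInℕ-suc-pivot zero    (suc x) x≢p = P.refl
punchInℕ-suc-pivot (suc p) zero    x≢p = P.refl
punchInℕ-suc-pivot (suc p) (suc x) x≢p = cong suc (punchInℕ-suc-pivot p x (x≢p ∘ cong suc))

punchInℕ-punchOutℕ-adj : ∀ j p → j ≢ p → j ≢ suc p →
  (punchInℕ j (punchOutℕ j p) ≡ p) × (punchInℕ j (suc (punchOutℕ j p)) ≡ suc p)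
punchInℕ-punchOutℕ-adj zero          zero    j≢p j≢sp = ⊥-elim (j≢p P.refl)
punchInℕ-punchOutℕ-adj zero          (suc p) j≢p j≢sp = P.refl , P.refl
punchInℕ-punchOutℕ-adj (suc zero)    zero    j≢p j≢sp = ⊥-elim (j≢sp P.refl)
punchInℕ-punchOutℕ-adj (suc (suc j)) zero    j≢p j≢sp = P.refl , P.refl
punchInℕ-punchOutℕ-adj (suc j)       (suc p) j≢p j≢sp
  with punchInℕ-punchOutℕ-adj j p (j≢p ∘ cong suc) (j≢sp ∘ cong suc)
... | e₁ , e₂ = cong suc e₁ , cong suc e₂

punchOutℕ-adj-< : ∀ j p r → j ℕ.≤ r → suc p ℕ.< suc r → j ≢ p → j ≢ suc p → suc (punchOutℕ j p) ℕ.< r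
punchOutℕ-adj-< zero          zero    r       _         _         j≢p j≢sp = ⊥-elim (j≢p P.refl)
punchOutℕ-adj-< zero          (suc p) r       _         (s≤s p<r) j≢p j≢sp = p<r
punchOutℕ-adj-< (suc zero)    zero    r       _         _         j≢p j≢sp = ⊥-elim (j≢sp P.refl)
punchOutℕ-adj-< (suc (suc j)) zero    (suc r) (s≤s j≤r) _         j≢p j≢sp = s≤s (ℕ.≤-trans (s≤s z≤n) j≤r)
punchOutℕ-adj-< (suc j)       (suc p) (suc r) (s≤s j≤r) (s≤s p<r) j≢p j≢sp =
  s≤s (punchOutℕ-adj-< j p r j≤r p<r (j≢p ∘ cong suc) (j≢sp ∘ cong suc))

punchInℕ-punchOutℕ-comm : ∀ l t b → punchInℕ (punchInℕ l t) (punchInℕ (punchOutℕ (punchInℕ l t) l) b) ≡ punchInℕ l (punchInℕ t b)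
punchInℕ-punchOutℕ-comm zero    t       b       = P.refl
punchInℕ-punchOutℕ-comm (suc l) zero    b       = P.refl
punchInℕ-punchOutℕ-comm (suc l) (suc t) zero    = P.refl
punchInℕ-punchOutℕ-comm (suc l) (suc t) (suc b) = cong suc (punchInℕ-punchOutℕ-comm l t b)

punchInℕ-punchOutℕ-parity : ∀ l t →
  (punchInℕ l t ℕ.+ punchOutℕ (punchInℕ l t) l ≡ suc (l ℕ.+ t)) ⊎
  (suc (punchInℕ l t ℕ.+ punchOutℕ (punchInℕ l t) l) ≡ l ℕ.+ t)
punchInℕ-punchOutℕ-parity zero    t       = inj₁ (cong suc (ℕ.+-identityʳ t))
punchInℕ-punchOutℕ-parity (suc l) zero    = inj₂ (P.sym (ℕ.+-identityʳ (suc l)))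
punchInℕ-punchOutℕ-parity (suc l) (suc t) with punchInℕ-punchOutℕ-parity l t
... | inj₁ e = inj₁ (cong suc (P.trans (ℕ.+-suc (punchInℕ l t) _) (P.trans (cong suc e) (cong suc (P.sym (ℕ.+-suc l t))))))
... | inj₂ e = inj₂ (cong suc (P.trans (cong suc (ℕ.+-suc (punchInℕ l t) _)) (P.trans (cong suc e) (P.sym (ℕ.+-suc l t)))))

swapAdjℕ-self : ∀ p → swapAdjℕ p p ≡ suc p
swapAdjℕ-self zero    = P.refl
swapAdjℕ-self (suc p) = cong suc (swapAdjℕ-self p)

swapAdjℕ-suc : ∀ p → swapAdjℕ p (suc p) ≡ p
swapAdjℕ-suc zero    = P.refl
swapAdjℕ-suc (suc p) = cong suc (swapAdjℕ-suc p)

swapAdjℕ-other : ∀ p x → x ≢ p → x ≢ suc p → swapAdjℕ p x ≡ x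
swapAdjℕ-other zero    zero          x≢p x≢sp = ⊥-elim (x≢p P.refl)
swapAdjℕ-other zero    (suc zero)    x≢p x≢sp = ⊥-elim (x≢sp P.refl)
swapAdjℕ-other zero    (suc (suc x)) x≢p x≢sp = P.refl
swapAdjℕ-other (suc p) zero          x≢p x≢sp = P.refl
swapAdjℕ-other (suc p) (suc x)       x≢p x≢sp = cong suc (swapAdjℕ-other p x (x≢p ∘ cong suc) (x≢sp ∘ cong suc))

swapAdjℕ-< : ∀ p x r → x ℕ.< r → suc p ℕ.< r → swapAdjℕ p x ℕ.< r
swapAdjℕ-< zero    zero          r       x<r       sp<r       = sp<r
swapAdjℕ-< zero    (suc zero)    (suc r) x<r       sp<r       = s≤s z≤n
swapAdjℕ-< zero    (suc (suc x)) r       x<r       sp<r       = x<r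
swapAdjℕ-< (suc p) zero          r       x<r       sp<r       = x<r
swapAdjℕ-< (suc p) (suc x)       (suc r) (s≤s x<r) (s≤s sp<r) = s≤s (swapAdjℕ-< p x r x<r sp<r)

swapAdjℕ-punchIn : ∀ j p x → j ≢ p → j ≢ suc p →
  swapAdjℕ p (punchInℕ j x) ≡ punchInℕ j (swapAdjℕ (punchOutℕ j p) x)
swapAdjℕ-punchIn zero          zero    x             j≢p j≢sp = ⊥-elim (j≢p P.refl)
swapAdjℕ-punchIn zero          (suc p) x             j≢p j≢sp = P.refl
swapAdjℕ-punchIn (suc zero)    zero    x             j≢p j≢sp = ⊥-elim (j≢sp P.refl)
swapAdjℕ-punchIn (suc (suc j)) zero    zero          j≢p j≢sp = P.refl
swapAdjℕ-punchIn (suc (suc j)) zero    (suc zero)    j≢p j≢sp = P.refl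
swapAdjℕ-punchIn (suc (suc j)) zero    (suc (suc x)) j≢p j≢sp = P.refl
swapAdjℕ-punchIn (suc j)       (suc p) zero          j≢p j≢sp = P.refl
swapAdjℕ-punchIn (suc j)       (suc p) (suc x)       j≢p j≢sp =
  cong suc (swapAdjℕ-punchIn j p x (j≢p ∘ cong suc) (j≢sp ∘ cong suc))

swapAdjℕ-punchIn-self : ∀ p x → swapAdjℕ p (punchInℕ p x) ≡ punchInℕ (suc p) x
swapAdjℕ-punchIn-self zero    zero    = P.refl
swapAdjℕ-punchIn-self zero    (suc x) = P.refl
swapAdjℕ-punchIn-self (suc p) zero    = P.refl
swapAdjℕ-punchIn-self (suc p) (suc x) = cong suc (swapAdjℕ-punchIn-self p x)

swapAdjℕ-punchIn-suc : ∀ p x → swapAdjℕ p (punchInℕ (suc p) x) ≡ punchInℕ p x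
swapAdjℕ-punchIn-suc zero    zero    = P.refl
swapAdjℕ-punchIn-suc zero    (suc x) = P.refl
swapAdjℕ-punchIn-suc (suc p) zero    = P.refl
swapAdjℕ-punchIn-suc (suc p) (suc x) = cong suc (swapAdjℕ-punchIn-suc p x)

∸-distrib-+ : ∀ {l₁ h₁ l₂ h₂} → l₁ ℕ.≤ h₁ → l₂ ℕ.≤ h₂ → (h₁ ℕ.+ h₂) ∸ (l₁ ℕ.+ l₂) ≡ (h₁ ∸ l₁) ℕ.+ (h₂ ∸ l₂)
∸-distrib-+ {l₁} {h₁} {l₂} {h₂} l₁≤h₁ l₂≤h₂ = begin
  (h₁ ℕ.+ h₂) ∸ (l₁ ℕ.+ l₂)                               ≡⟨ cong₂ (λ u v → (u ℕ.+ v) ∸ (l₁ ℕ.+ l₂)) (P.sym (ℕ.m+[n∸m]≡n l₁≤h₁)) (P.sym (ℕ.m+[n∸m]≡n l₂≤h₂)) ⟩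
  (l₁ ℕ.+ (h₁ ∸ l₁) ℕ.+ (l₂ ℕ.+ (h₂ ∸ l₂))) ∸ (l₁ ℕ.+ l₂) ≡⟨ cong (ℕ._∸ (l₁ ℕ.+ l₂)) (shuffle l₁ (h₁ ∸ l₁) l₂ (h₂ ∸ l₂)) ⟩
  (l₁ ℕ.+ l₂ ℕ.+ ((h₁ ∸ l₁) ℕ.+ (h₂ ∸ l₂))) ∸ (l₁ ℕ.+ l₂) ≡⟨ ℕ.m+n∸m≡n (l₁ ℕ.+ l₂) _ ⟩
  (h₁ ∸ l₁) ℕ.+ (h₂ ∸ l₂)                                 ∎
  where
  open P.≡-Reasoning
  shuffle : ∀ a b c d → a ℕ.+ b ℕ.+ (c ℕ.+ d) ≡ a ℕ.+ c ℕ.+ (b ℕ.+ d)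
  shuffle = solve-∀

sumℕ : ∀ r → (Fin r → ℕ) → ℕ
sumℕ _ = ℕSum.sum

Increasing : ∀ {r} → (Fin r → ℕ) → Set
Increasing f = ∀ x y → toℕ x ℕ.< toℕ y → f x ℕ.< f y

increasing-suc : ∀ {r} {f : Fin (suc r) → ℕ} → Increasing f → Increasing (f ∘ Fin.suc)
increasing-suc sm x y lt = sm (Fin.suc x) (Fin.suc y) (s≤s lt)

increasing-punchIn : ∀ {r} {f : Fin (suc r) → ℕ} s0 → Increasing f → Increasing (f ∘ punchIn s0)
increasing-punchIn s0 sm x y lt = sm (punchIn s0 x) (punchIn s0 y)
  (P.subst₂ ℕ._<_ (P.sym (toℕ-punchIn s0 x)) (P.sym (toℕ-punchIn s0 y)) (punchInℕ-mono-< (toℕ s0) (toℕ x) (toℕ y) lt))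

increasing-injective : ∀ {r} {f : Fin r → ℕ} → Increasing f → ∀ x y → f x ≡ f y → x ≡ y
increasing-injective sm x y e with ℕ.<-cmp (toℕ x) (toℕ y)
... | tri< lt _ _ = ⊥-elim (ℕ.<-irrefl e (sm x y lt))
... | tri≈ _ eq _ = FinP.toℕ-injective eq
... | tri> _ _ gt = ⊥-elim (ℕ.<-irrefl (P.sym e) (sm y x gt))

increasing-zero : ∀ {r} {f : Fin (suc r) → ℕ} → Increasing f → ∀ l → f Fin.zero ℕ.≤ f l
increasing-zero sm Fin.zero = ℕ.≤-refl
increasing-zero sm (Fin.suc l) = ℕ.<⇒≤ (sm Fin.zero (Fin.suc l) (s≤s z≤n))

increasing-bound : ∀ n r (τ : Fin r → ℕ) → Increasing τ → (∀ l → τ l ℕ.< n) → ∀ l → τ l ℕ.+ r ℕ.≤ n ℕ.+ toℕ l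
increasing-bound n (suc zero) τ sm b Fin.zero = P.subst (ℕ._≤ n ℕ.+ 0) (ℕ.+-comm 1 (τ Fin.zero)) (P.subst (suc (τ Fin.zero) ℕ.≤_) (P.sym (ℕ.+-identityʳ n)) (b Fin.zero))
increasing-bound n (suc (suc r)) τ sm b Fin.zero = ℕ.≤-trans (ℕ.≤-reflexive (ℕ.+-suc (τ Fin.zero) (suc r)))
  (ℕ.≤-trans (ℕ.+-monoˡ-≤ (suc r) (sm Fin.zero (Fin.suc Fin.zero) (s≤s z≤n))) (increasing-bound n (suc r) (τ ∘ Fin.suc) (increasing-suc sm) (b ∘ Fin.suc) Fin.zero))
increasing-bound n (suc r) τ sm b (Fin.suc l) = P.subst₂ ℕ._≤_ (P.sym (ℕ.+-suc (τ (Fin.suc l)) r)) (P.sym (ℕ.+-suc n (toℕ l)))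
  (s≤s (increasing-bound n r (τ ∘ Fin.suc) (increasing-suc sm) (b ∘ Fin.suc) l))

sumℕ-zero : ∀ r → sumℕ r (λ _ → 0) ≡ 0
sumℕ-zero r = ℕSum.sum-replicate-zero r

sumℕ-mono-≤ : ∀ r (f g : Fin r → ℕ) → (∀ i → f i ℕ.≤ g i) → sumℕ r f ℕ.≤ sumℕ r g
sumℕ-mono-≤ zero f g h = z≤n
sumℕ-mono-≤ (suc r) f g h = ℕ.+-mono-≤ (h Fin.zero) (sumℕ-mono-≤ r (f ∘ Fin.suc) (g ∘ Fin.suc) (h ∘ Fin.suc))

sumℕ-+-const : ∀ r (f : Fin r → ℕ) W → sumℕ r (λ i → f i ℕ.+ W) ≡ sumℕ r f ℕ.+ r ℕ.* W
sumℕ-+-const zero f W = P.refl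
sumℕ-+-const (suc r) f W = P.trans (P.cong (f Fin.zero ℕ.+ W ℕ.+_) (sumℕ-+-const r (f ∘ Fin.suc) W)) (e (f Fin.zero) W (sumℕ r (f ∘ Fin.suc)) (r ℕ.* W))
  where e : ∀ a b c d → a ℕ.+ b ℕ.+ (c ℕ.+ d) ≡ a ℕ.+ c ℕ.+ (b ℕ.+ d)
        e = solve-∀

∃-function? : ∀ {q p} j (Pr : (Fin j → Fin q) → Set p) → (∀ f g → (∀ i → f i ≡ g i) → Pr f → Pr g) →
              (∀ f → Dec (Pr f)) → Dec (Σ (Fin j → Fin q) Pr)
∃-function? zero Pr resp d with d (λ ())
... | yes p = yes ((λ ()) , p)
... | no np = no (λ { (f , p) → np (resp f (λ ()) (λ ()) p) })
∃-function? (suc j) Pr resp d with FinP.any? (λ x → ∃-function? j (λ g → Pr (x ∷ g)) (λ f g e → resp (x ∷ f) (x ∷ g) (λ { Fin.zero → P.refl ; (Fin.suc i) → e i })) (λ g → d (x ∷ g)))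
... | yes (x , g , p) = yes (x ∷ g , p)
... | no np = no (λ { (f , p) → np (f Fin.zero , (f ∘ Fin.suc) , resp f _ (λ { Fin.zero → P.refl ; (Fin.suc i) → P.refl }) p) })

Positions : ∀ {p} → ℕ → ℕ → (ℕ → Set p) → Set p
Positions d N Pr = Σ (Fin d → ℕ) λ σ → Increasing σ × (∀ t → σ t ℕ.< N) × (∀ t → Pr (σ t))

positions-suc : ∀ {p d N} {Pr : ℕ → Set p} → Positions d N (Pr ∘ suc) → Positions d (suc N) Pr
positions-suc (σ , inc , bnd , pr) = suc ∘ σ , (λ x y lt → s≤s (inc x y lt)) , s≤s ∘ bnd , pr

positions-cons : ∀ {p d N} {Pr : ℕ → Set p} → Pr 0 → Positions d N (Pr ∘ suc) → Positions (suc d) (suc N) Pr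
positions-cons {Pr = Pr} p0 (σ , inc , bnd , pr) = σ′ , inc′ , bnd′ , pr′
  where
  σ′ : Fin (suc _) → ℕ
  σ′ Fin.zero    = 0
  σ′ (Fin.suc t) = suc (σ t)
  inc′ : Increasing σ′
  inc′ Fin.zero    (Fin.suc y) _          = s≤s z≤n
  inc′ (Fin.suc x) (Fin.suc y) (s≤s x<y) = s≤s (inc x y x<y)
  bnd′ : ∀ t → σ′ t ℕ.< suc _
  bnd′ Fin.zero    = s≤s z≤n
  bnd′ (Fin.suc t) = s≤s (bnd t)
  pr′ : ∀ t → Pr (σ′ t)
  pr′ Fin.zero    = p0
  pr′ (Fin.suc t) = pr t

positions-none : ∀ {p N} {Pr : ℕ → Set p} → Positions 0 N Pr
positions-none = (λ ()) , (λ ()) , (λ ()) , (λ ())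

pigeonhole : ∀ {p} N (Pr : ℕ → Set p) → (∀ x → Dec (Pr x)) → ∀ d e → d ℕ.+ e ≡ suc N →
             Positions d N Pr ⊎ Positions e N (¬_ ∘ Pr)
pigeonhole N       Pr Pr? zero    e       _  = inj₁ (positions-none {Pr = Pr})
pigeonhole zero    Pr Pr? (suc d) zero    _  = inj₂ (positions-none {Pr = ¬_ ∘ Pr})
pigeonhole zero    Pr Pr? (suc d) (suc e) de = ⊥-elim (ℕ.0≢1+n (P.sym (P.trans (P.sym (ℕ.+-suc d e)) (ℕ.suc-injective de))))
pigeonhole (suc N) Pr Pr? (suc d) e       de with Pr? 0
... | yes p0 = Sum.map (positions-cons {Pr = Pr} p0) (positions-suc {Pr = ¬_ ∘ Pr})
                 (pigeonhole N (Pr ∘ suc) (Pr? ∘ suc) d e (ℕ.suc-injective de))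
pigeonhole (suc N) Pr Pr? (suc d) zero    _  | no _ = inj₂ (positions-none {Pr = ¬_ ∘ Pr})
pigeonhole (suc N) Pr Pr? (suc d) (suc e) de | no ¬p0 = Sum.map (positions-suc {Pr = Pr}) (positions-cons {Pr = ¬_ ∘ Pr} ¬p0)
                 (pigeonhole N (Pr ∘ suc) (Pr? ∘ suc) (suc d) e (ℕ.suc-injective (P.trans (P.sym (ℕ.+-suc (suc d) e)) de)))

module FieldSums {c ℓ} (K : Field c ℓ) where
  open Field K
  open FieldOps K
  open import Algebra.Properties.Ring ring public
  open import Algebra.Properties.Semiring.Sum semiring using (sum; ∑-distrib-+; ∑-comm; sum-remove; *-distribˡ-sum)
  open import Algebra.Properties.CommutativeSemigroup +-commutativeSemigroup public
    using () renaming (interchange to +-interchange; x∙yz≈y∙xz to x+yz≈y+xz)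
  open import Algebra.Properties.CommutativeSemigroup *-commutativeSemigroup public
    using () renaming (x∙yz≈y∙xz to x*yz≈y*xz)

  -‿≈0 : ∀ {x} → x ≈ 0# → - x ≈ 0#
  -‿≈0 x≈0 = trans (-‿cong x≈0) -0#≈0#

  *≈0ʳ : ∀ {x y} → y ≈ 0# → x * y ≈ 0#
  *≈0ʳ {x} y≈0 = trans (*-congˡ y≈0) (zeroʳ x)

  *≈0ˡ : ∀ {x y} → x ≈ 0# → x * y ≈ 0#
  *≈0ˡ {_} {y} x≈0 = trans (*-congʳ x≈0) (zeroˡ y)

  +≈0 : ∀ {x y} → x ≈ 0# → y ≈ 0# → x + y ≈ 0#
  +≈0 x≈0 y≈0 = trans (+-cong x≈0 y≈0) (+-identityˡ 0#)

  +-cancel-zeroˡ : ∀ {x y} → x ≈ 0# → x + y ≈ 0# → y ≈ 0#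
  +-cancel-zeroˡ {x} {y} x≈0 x+y≈0 = trans (sym (+-identityˡ y)) (trans (+-congʳ (sym x≈0)) x+y≈0)

  *-cancel-zeroˡ : ∀ {x y} → ¬ (x ≈ 0#) → x * y ≈ 0# → y ≈ 0#
  *-cancel-zeroˡ {x} {y} x≉0 xy≈0 with inverse x x≉0
  ... | w , xw≈1 = begin
    y           ≈⟨ sym (*-identityˡ y) ⟩
    1# * y      ≈⟨ *-congʳ (sym (trans (*-comm w x) xw≈1)) ⟩
    (w * x) * y ≈⟨ *-assoc w x y ⟩
    w * (x * y) ≈⟨ *≈0ʳ xy≈0 ⟩
    0#          ∎
    where open import Relation.Binary.Reasoning.Setoid setoid

  *-nonzero : ∀ {x y} → ¬ (x ≈ 0#) → ¬ (y ≈ 0#) → ¬ (x * y ≈ 0#)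
  *-nonzero x≉0 y≉0 = y≉0 ∘ *-cancel-zeroˡ x≉0

  sumF≡sum : ∀ n (f : Fin n → Carrier) → sumF n f ≡ sum f
  sumF≡sum zero    f = P.refl
  sumF≡sum (suc n) f = cong (f Fin.zero +_) (sumF≡sum n (f ∘ Fin.suc))

  sumF-cong : ∀ n {f g : Fin n → Carrier} → (∀ i → f i ≈ g i) → sumF n f ≈ sumF n g
  sumF-cong zero    f≈g = refl
  sumF-cong (suc n) f≈g = +-cong (f≈g Fin.zero) (sumF-cong n (f≈g ∘ Fin.suc))

  sumF-zero : ∀ n {f : Fin n → Carrier} → (∀ i → f i ≈ 0#) → sumF n f ≈ 0#
  sumF-zero zero    f≈0 = refl
  sumF-zero (suc n) f≈0 = +≈0 (f≈0 Fin.zero) (sumF-zero n (f≈0 ∘ Fin.suc))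

  sumF-+ : ∀ n (f g : Fin n → Carrier) → sumF n (λ i → f i + g i) ≈ sumF n f + sumF n g
  sumF-+ n f g rewrite sumF≡sum n (λ i → f i + g i) | sumF≡sum n f | sumF≡sum n g = ∑-distrib-+ f g

  *-distribˡ-sumF : ∀ n a (f : Fin n → Carrier) → a * sumF n f ≈ sumF n (λ i → a * f i)
  *-distribˡ-sumF n a f rewrite sumF≡sum n f | sumF≡sum n (λ i → a * f i) = *-distribˡ-sum a f

  sumF-remove : ∀ n (f : Fin (suc n) → Carrier) (j : Fin (suc n)) →
                sumF (suc n) f ≈ f j + sumF n (f ∘ punchIn j)
  sumF-remove n f j rewrite sumF≡sum (suc n) f | sumF≡sum n (f ∘ punchIn j) = sum-remove f

  sumF-comm : ∀ n m (f : Fin n → Fin m → Carrier) →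
              sumF n (λ i → sumF m (f i)) ≈ sumF m (λ j → sumF n (λ i → f i j))
  sumF-comm n m f = begin
    sumF n (λ i → sumF m (f i))          ≈⟨ sumF-cong n (λ i → reflexive (sumF≡sum m (f i))) ⟩
    sumF n (λ i → sum (f i))             ≡⟨ sumF≡sum n _ ⟩
    sum (λ i → sum (f i))                ≈⟨ ∑-comm f ⟩
    sum (λ j → sum (λ i → f i j))        ≡⟨ P.sym (sumF≡sum m _) ⟩
    sumF m (λ j → sum (λ i → f i j))     ≈⟨ sumF-cong m (λ j → reflexive (P.sym (sumF≡sum n (λ i → f i j)))) ⟩
    sumF m (λ j → sumF n (λ i → f i j))  ∎
    where open import Relation.Binary.Reasoning.Setoid setoid

  sumF-single : ∀ n (f : Fin n → Carrier) (j : Fin n) → (∀ i → i ≢ j → f i ≈ 0#) → sumF n f ≈ f j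
  sumF-single (suc n) f j f≈0 = trans (sumF-remove n f j)
    (trans (+-congˡ (sumF-zero n (λ i → f≈0 (punchIn j i) (FinP.punchInᵢ≢i j i)))) (+-identityʳ _))

  -‿sumF : ∀ n (f : Fin n → Carrier) → - sumF n f ≈ sumF n (λ i → - f i)
  -‿sumF zero    f = -0#≈0#
  -‿sumF (suc n) f = trans (sym (-‿+-comm _ _)) (+-congˡ (-‿sumF n (f ∘ Fin.suc)))

  alt-cong : ∀ e {x y} → x ≈ y → alt e x ≈ alt e y
  alt-cong zero    x≈y = x≈y
  alt-cong (suc e) x≈y = -‿cong (alt-cong e x≈y)

  alt-≡ : ∀ {e e'} x → e ≡ e' → alt e x ≈ alt e' x
  alt-≡ x P.refl = refl

  alt-zero : ∀ e {x} → x ≈ 0# → alt e x ≈ 0#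
  alt-zero zero    x≈0 = x≈0
  alt-zero (suc e) x≈0 = -‿≈0 (alt-zero e x≈0)

  alt-zero⁻¹ : ∀ e {x} → alt e x ≈ 0# → x ≈ 0#
  alt-zero⁻¹ zero    ax≈0 = ax≈0
  alt-zero⁻¹ (suc e) ax≈0 = alt-zero⁻¹ e (trans (sym (-‿involutive _)) (-‿≈0 ax≈0))

  alt-*ʳ : ∀ e a x → alt e (a * x) ≈ a * alt e x
  alt-*ʳ zero    a x = refl
  alt-*ʳ (suc e) a x = trans (-‿cong (alt-*ʳ e a x)) (-‿distribʳ-* a _)

  alt-distrib-+ : ∀ e x y → alt e (x + y) ≈ alt e x + alt e y
  alt-distrib-+ zero    x y = refl
  alt-distrib-+ (suc e) x y = trans (-‿cong (alt-distrib-+ e x y)) (sym (-‿+-comm _ _))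

  alt-neg : ∀ e x → alt e (- x) ≈ - alt e x
  alt-neg zero    x = refl
  alt-neg (suc e) x = -‿cong (alt-neg e x)

  alt-+ℕ : ∀ a b x → alt (a ℕ.+ b) x ≈ alt a (alt b x)
  alt-+ℕ zero    b x = refl
  alt-+ℕ (suc a) b x = -‿cong (alt-+ℕ a b x)

  alt-suc-suc : ∀ e x → alt (suc (suc e)) x ≈ alt e x
  alt-suc-suc e x = -‿involutive _

  alt-sumF : ∀ e n (f : Fin n → Carrier) → alt e (sumF n f) ≈ sumF n (λ i → alt e (f i))
  alt-sumF zero    n f = refl
  alt-sumF (suc e) n f = trans (-‿cong (alt-sumF e n f)) (-‿sumF n _)

  sumF-cast : ∀ {x y} (e : x ≡ y) (f : Fin x → Carrier) → sumF x f ≈ sumF y (f ∘ Fin.cast (P.sym e))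
  sumF-cast {x} P.refl f = sumF-cong x (λ i → reflexive (P.cong f (P.sym (FinP.cast-is-id P.refl i))))

module Determinants {c ℓ} (K : Field c ℓ) where
  open Field K
  open FieldOps K
  open FieldSums K
  open import Relation.Binary.Reasoning.Setoid setoid

  Mat : ℕ → Set c
  Mat r = Fin r → Fin r → Carrier

  minor : ∀ {r} → Mat (suc r) → Fin (suc r) → Mat r
  minor M j s t = M (Fin.suc s) (punchIn j t)

  det-cong : ∀ r {M N : Mat r} → (∀ s t → M s t ≈ N s t) → det r M ≈ det r N
  det-cong zero e = refl
  det-cong (suc r) e = sumF-cong (suc r) (λ j →
    alt-cong (toℕ j) (*-cong (e Fin.zero j) (det-cong r (λ s t → e (Fin.suc s) (punchIn j t)))))

  det-linear : ∀ r (M N1 N2 : Mat r) (l : Fin r) μ →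
    (∀ s → M s l ≈ N1 s l + μ * N2 s l) →
    (∀ s t → t ≢ l → M s t ≈ N1 s t) → (∀ s t → t ≢ l → M s t ≈ N2 s t) →
    det r M ≈ det r N1 + μ * det r N2
  det-linear (suc r) M N1 N2 l μ hl h1 h2 = begin
    det (suc r) M ≈⟨ sumF-cong (suc r) term ⟩
    sumF (suc r) (λ j → A j + μ * B j) ≈⟨ sumF-+ (suc r) A (λ j → μ * B j) ⟩
    sumF (suc r) A + sumF (suc r) (λ j → μ * B j) ≈⟨ +-congˡ (sym (*-distribˡ-sumF (suc r) μ B)) ⟩
    det (suc r) N1 + μ * det (suc r) N2 ∎
    where
    A : Fin (suc r) → Carrier
    A j = alt (toℕ j) (N1 Fin.zero j * det r (minor N1 j))
    B : Fin (suc r) → Carrier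
    B j = alt (toℕ j) (N2 Fin.zero j * det r (minor N2 j))
    alg1 : ∀ e m a b D D1 D2 → m ≈ a + μ * b → D ≈ D1 → D ≈ D2 → alt e (m * D) ≈ alt e (a * D1) + μ * alt e (b * D2)
    alg1 e m a b D D1 D2 mm p q = begin
      alt e (m * D) ≈⟨ alt-cong e (trans (*-congʳ mm) (distribʳ D a (μ * b))) ⟩
      alt e (a * D + (μ * b) * D) ≈⟨ alt-distrib-+ e _ _ ⟩
      alt e (a * D) + alt e ((μ * b) * D) ≈⟨ +-cong (alt-cong e (*-congˡ p)) (alt-cong e (trans (*-assoc μ b D) (*-congˡ (*-congˡ q)))) ⟩
      alt e (a * D1) + alt e (μ * (b * D2)) ≈⟨ +-congˡ (alt-*ʳ e μ _) ⟩
      alt e (a * D1) + μ * alt e (b * D2) ∎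
    alg2 : ∀ e a a1 a2 D D1 D2 → a ≈ a1 → a ≈ a2 → D ≈ D1 + μ * D2 → alt e (a * D) ≈ alt e (a1 * D1) + μ * alt e (a2 * D2)
    alg2 e a a1 a2 D D1 D2 p q d = begin
      alt e (a * D) ≈⟨ alt-cong e (*-congˡ d) ⟩
      alt e (a * (D1 + μ * D2)) ≈⟨ alt-cong e (distribˡ a D1 (μ * D2)) ⟩
      alt e (a * D1 + a * (μ * D2)) ≈⟨ alt-distrib-+ e _ _ ⟩
      alt e (a * D1) + alt e (a * (μ * D2)) ≈⟨ +-cong (alt-cong e (*-congʳ p)) (alt-cong e (trans (x*yz≈y*xz a μ D2) (*-congˡ (*-congʳ q)))) ⟩
      alt e (a1 * D1) + alt e (μ * (a2 * D2)) ≈⟨ +-congˡ (alt-*ʳ e μ _) ⟩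
      alt e (a1 * D1) + μ * alt e (a2 * D2) ∎
    term : ∀ j → alt (toℕ j) (M Fin.zero j * det r (minor M j)) ≈ A j + μ * B j
    term j with j Fin.≟ l
    ... | yes P.refl = alg1 (toℕ j) _ _ _ _ _ _ (hl Fin.zero)
            (det-cong r (λ s t → h1 (Fin.suc s) (punchIn j t) (FinP.punchInᵢ≢i j t)))
            (det-cong r (λ s t → h2 (Fin.suc s) (punchIn j t) (FinP.punchInᵢ≢i j t)))
    ... | no j≢l = alg2 (toℕ j) _ _ _ _ _ _ (h1 Fin.zero j j≢l) (h2 Fin.zero j j≢l)
            (det-linear r (minor M j) (minor N1 j) (minor N2 j) (punchOut j≢l) μ
              (λ s → P.subst (λ z → M (Fin.suc s) z ≈ N1 (Fin.suc s) z + μ * N2 (Fin.suc s) z)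
                        (P.sym (FinP.punchIn-punchOut j≢l)) (hl (Fin.suc s)))
              (λ s t t≢ → h1 (Fin.suc s) (punchIn j t) (λ e → t≢ (FinP.punchIn-injective j t _ (P.trans e (P.sym (FinP.punchIn-punchOut j≢l))))))
              (λ s t t≢ → h2 (Fin.suc s) (punchIn j t) (λ e → t≢ (FinP.punchIn-injective j t _ (P.trans e (P.sym (FinP.punchIn-punchOut j≢l)))))))

  det-zeroColumn : ∀ r (M : Mat r) (l : Fin r) → (∀ s → M s l ≈ 0#) → det r M ≈ 0#
  det-zeroColumn r M l h = x+x≈x⇒x≈0 _ (sym (trans
      (det-linear r M M M l 1# (λ s → trans (h s) (sym (trans (+-congˡ (*-identityˡ _)) (+≈0 (h s) (h s)))))
        (λ s t _ → refl) (λ s t _ → refl))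
      (+-congˡ (*-identityˡ _))))

  sumF-swapAdj : ∀ n p (f g : Fin n → Carrier) → suc p ℕ.< n →
    (∀ j → toℕ j ≢ p → toℕ j ≢ suc p → f j ≈ g j) →
    (∀ j j' → toℕ j ≡ p → toℕ j' ≡ suc p → (f j ≈ g j') × (f j' ≈ g j)) →
    sumF n f ≈ sumF n g
  sumF-swapAdj (suc (suc n)) zero f g b h1 h2 = begin
    f Fin.zero + (f (Fin.suc Fin.zero) + sumF n (λ i → f (Fin.suc (Fin.suc i))))
      ≈⟨ +-cong (proj₁ pr) (+-cong (proj₂ pr) (sumF-cong n (λ i → h1 (Fin.suc (Fin.suc i)) (λ ()) (λ ())))) ⟩
    g (Fin.suc Fin.zero) + (g Fin.zero + sumF n (λ i → g (Fin.suc (Fin.suc i))))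
      ≈⟨ x+yz≈y+xz _ _ _ ⟩
    g Fin.zero + (g (Fin.suc Fin.zero) + sumF n (λ i → g (Fin.suc (Fin.suc i)))) ∎
    where pr = h2 Fin.zero (Fin.suc Fin.zero) P.refl P.refl
  sumF-swapAdj (suc n) (suc p) f g (ℕ.s≤s b) h1 h2 =
    +-cong (h1 Fin.zero (λ ()) (λ ()))
      (sumF-swapAdj n p (f ∘ Fin.suc) (g ∘ Fin.suc) b
        (λ j a c → h1 (Fin.suc j) (λ e → a (P.cong ℕ.pred e)) (λ e → c (P.cong ℕ.pred e)))
        (λ j j' a c → h2 (Fin.suc j) (Fin.suc j') (P.cong suc a) (P.cong suc c)))

  sumF-cancelAdj : ∀ n p (f : Fin n → Carrier) → suc p ℕ.< n →
    (∀ j → toℕ j ≢ p → toℕ j ≢ suc p → f j ≈ 0#) →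
    (∀ j j' → toℕ j ≡ p → toℕ j' ≡ suc p → f j + f j' ≈ 0#) →
    sumF n f ≈ 0#
  sumF-cancelAdj (suc (suc n)) zero f b h1 h2 = begin
    f Fin.zero + (f (Fin.suc Fin.zero) + sumF n (λ i → f (Fin.suc (Fin.suc i))))
      ≈⟨ sym (+-assoc _ _ _) ⟩
    (f Fin.zero + f (Fin.suc Fin.zero)) + sumF n (λ i → f (Fin.suc (Fin.suc i)))
      ≈⟨ +≈0 (h2 Fin.zero (Fin.suc Fin.zero) P.refl P.refl) (sumF-zero n (λ i → h1 (Fin.suc (Fin.suc i)) (λ ()) (λ ()))) ⟩
    0# ∎
  sumF-cancelAdj (suc n) (suc p) f (ℕ.s≤s b) h1 h2 =
    +≈0 (h1 Fin.zero (λ ()) (λ ()))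
      (sumF-cancelAdj n p (f ∘ Fin.suc) b
        (λ j a c → h1 (Fin.suc j) (λ e → a (P.cong ℕ.pred e)) (λ e → c (P.cong ℕ.pred e)))
        (λ j j' a c → h2 (Fin.suc j) (Fin.suc j') (P.cong suc a) (P.cong suc c)))

  det-swapAdj : ∀ r (M M' : Mat r) p → suc p ℕ.< r →
    (∀ s t t' → toℕ t' ≡ swapAdjℕ p (toℕ t) → M' s t ≈ M s t') → det r M' ≈ - det r M
  det-swapAdj (suc r) M M' p b h = begin
    det (suc r) M' ≈⟨ sumF-swapAdj (suc r) p f g b h1 h2 ⟩
    sumF (suc r) g ≈⟨ sym (-‿sumF (suc r) (λ j → alt (toℕ j) (M Fin.zero j * det r (minor M j)))) ⟩
    - det (suc r) M ∎
    where
    f g : Fin (suc r) → Carrier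
    f j = alt (toℕ j) (M' Fin.zero j * det r (minor M' j))
    g j = - alt (toℕ j) (M Fin.zero j * det r (minor M j))
    h1 : ∀ j → toℕ j ≢ p → toℕ j ≢ suc p → f j ≈ g j
    h1 j a c = begin
      alt (toℕ j) (M' Fin.zero j * det r (minor M' j))
        ≈⟨ alt-cong (toℕ j) (*-cong (h Fin.zero j j (P.sym (swapAdjℕ-other p (toℕ j) a c)))
             (det-swapAdj r (minor M j) (minor M' j) (punchOutℕ (toℕ j) p)
               (punchOutℕ-adj-< (toℕ j) p r (FinP.toℕ≤pred[n] j) b a c)
               (λ s t t' e → h (Fin.suc s) (punchIn j t) (punchIn j t')
                  (P.trans (toℕ-punchIn j t') (P.trans (P.cong (punchInℕ (toℕ j)) e)
                    (P.trans (P.sym (swapAdjℕ-punchIn (toℕ j) p (toℕ t) a c)) (P.cong (swapAdjℕ p) (P.sym (toℕ-punchIn j t))))))))) ⟩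
      alt (toℕ j) (M Fin.zero j * - det r (minor M j))
        ≈⟨ alt-cong (toℕ j) (sym (-‿distribʳ-* _ _)) ⟩
      alt (toℕ j) (- (M Fin.zero j * det r (minor M j)))
        ≈⟨ alt-neg (toℕ j) _ ⟩
      g j ∎
    h2 : ∀ j j' → toℕ j ≡ p → toℕ j' ≡ suc p → (f j ≈ g j') × (f j' ≈ g j)
    h2 j j' ej ej' = e1 , e2
      where
      e1 : f j ≈ g j'
      e1 = begin
        alt (toℕ j) (M' Fin.zero j * det r (minor M' j))
          ≈⟨ alt-cong (toℕ j) (*-cong (h Fin.zero j j' (P.trans ej' (P.sym (P.trans (P.cong (swapAdjℕ p) ej) (swapAdjℕ-self p)))))
               (det-cong r (λ s t → h (Fin.suc s) (punchIn j t) (punchIn j' t)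
                 (P.trans (toℕ-punchIn j' t) (P.trans (P.cong (λ z → punchInℕ z (toℕ t)) ej')
                   (P.trans (P.trans (P.sym (swapAdjℕ-punchIn-self p (toℕ t))) (P.cong (λ z → swapAdjℕ p (punchInℕ z (toℕ t))) (P.sym ej))) (P.cong (swapAdjℕ p) (P.sym (toℕ-punchIn j t))))))))) ⟩
        alt (toℕ j) (M Fin.zero j' * det r (minor M j'))
          ≈⟨ alt-≡ _ ej ⟩
        alt p (M Fin.zero j' * det r (minor M j'))
          ≈⟨ sym (-‿involutive _) ⟩
        - alt (suc p) (M Fin.zero j' * det r (minor M j'))
          ≈⟨ -‿cong (alt-≡ _ (P.sym ej')) ⟩
        g j' ∎
      e2 : f j' ≈ g j
      e2 = begin
        alt (toℕ j') (M' Fin.zero j' * det r (minor M' j'))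
          ≈⟨ alt-cong (toℕ j') (*-cong (h Fin.zero j' j (P.trans ej (P.sym (P.trans (P.cong (swapAdjℕ p) ej') (swapAdjℕ-suc p)))))
               (det-cong r (λ s t → h (Fin.suc s) (punchIn j' t) (punchIn j t)
                 (P.trans (toℕ-punchIn j t) (P.trans (P.cong (λ z → punchInℕ z (toℕ t)) ej)
                   (P.trans (P.trans (P.sym (swapAdjℕ-punchIn-suc p (toℕ t))) (P.cong (λ z → swapAdjℕ p (punchInℕ z (toℕ t))) (P.sym ej'))) (P.cong (swapAdjℕ p) (P.sym (toℕ-punchIn j' t))))))))) ⟩
        alt (toℕ j') (M Fin.zero j * det r (minor M j))
          ≈⟨ alt-≡ _ ej' ⟩
        - alt p (M Fin.zero j * det r (minor M j))
          ≈⟨ -‿cong (alt-≡ _ (P.sym ej)) ⟩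
        g j ∎

  det-equalAdj : ∀ r (M : Mat r) p → suc p ℕ.< r →
    (∀ s j j' → toℕ j ≡ p → toℕ j' ≡ suc p → M s j ≈ M s j') → det r M ≈ 0#
  det-equalAdj (suc r) M p b h = sumF-cancelAdj (suc r) p _ b h1 h2
    where
    h1 : ∀ j → toℕ j ≢ p → toℕ j ≢ suc p → alt (toℕ j) (M Fin.zero j * det r (minor M j)) ≈ 0#
    h1 j a c = alt-zero (toℕ j) (*≈0ʳ (det-equalAdj r (minor M j) (punchOutℕ (toℕ j) p)
                 (punchOutℕ-adj-< (toℕ j) p r (FinP.toℕ≤pred[n] j) b a c)
                 (λ s t t' et et' → h (Fin.suc s) (punchIn j t) (punchIn j t')
                    (P.trans (toℕ-punchIn j t) (P.trans (P.cong (punchInℕ (toℕ j)) et) (proj₁ (punchInℕ-punchOutℕ-adj (toℕ j) p a c))))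
                    (P.trans (toℕ-punchIn j t') (P.trans (P.cong (punchInℕ (toℕ j)) et') (proj₂ (punchInℕ-punchOutℕ-adj (toℕ j) p a c)))))))
    h2 : ∀ j j' → toℕ j ≡ p → toℕ j' ≡ suc p →
         alt (toℕ j) (M Fin.zero j * det r (minor M j)) + alt (toℕ j') (M Fin.zero j' * det r (minor M j')) ≈ 0#
    h2 j j' ej ej' = begin
      alt (toℕ j) (M Fin.zero j * det r (minor M j)) + alt (toℕ j') (M Fin.zero j' * det r (minor M j'))
        ≈⟨ +-cong (alt-≡ _ ej) (alt-≡ _ ej') ⟩
      alt p (M Fin.zero j * det r (minor M j)) + - alt p (M Fin.zero j' * det r (minor M j'))
        ≈⟨ +-congˡ (-‿cong (alt-cong p (*-cong (sym (h Fin.zero j j' ej ej')) (det-cong r mn)))) ⟩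
      alt p (M Fin.zero j * det r (minor M j)) + - alt p (M Fin.zero j * det r (minor M j))
        ≈⟨ -‿inverseʳ _ ⟩
      0# ∎
      where
      mn : ∀ s t → minor M j' s t ≈ minor M j s t
      mn s t with toℕ t ℕ.≟ p
      ... | yes et = h (Fin.suc s) (punchIn j' t) (punchIn j t)
              (P.trans (toℕ-punchIn j' t) (P.trans (P.cong₂ punchInℕ ej' et) (punchInℕ-suc-self p)))
              (P.trans (toℕ-punchIn j t) (P.trans (P.cong₂ punchInℕ ej et) (punchInℕ-self p)))
      ... | no ne = reflexive (P.cong (M (Fin.suc s)) (FinP.toℕ-injective
              (P.trans (toℕ-punchIn j' t) (P.trans (P.cong (λ z → punchInℕ z (toℕ t)) ej')
                (P.trans (P.sym (punchInℕ-suc-pivot p (toℕ t) ne)) (P.trans (P.cong (λ z → punchInℕ z (toℕ t)) (P.sym ej)) (P.sym (toℕ-punchIn j t))))))))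

  swapAdjFin : ∀ {r} p → suc p ℕ.< r → Fin r → Fin r
  swapAdjFin {r} p b t = Fin.fromℕ< (swapAdjℕ-< p (toℕ t) r (FinP.toℕ<n t) b)

  toℕ-swapAdjFin : ∀ {r} p (b : suc p ℕ.< r) t → toℕ (swapAdjFin p b t) ≡ swapAdjℕ p (toℕ t)
  toℕ-swapAdjFin p b t = FinP.toℕ-fromℕ< _

  det-equalAt : ∀ d r (M : Mat r) a b → toℕ b ≡ suc (toℕ a ℕ.+ d) → (∀ s → M s a ≈ M s b) → det r M ≈ 0#
  det-equalAt zero r M a b e h = det-equalAdj r M (toℕ a) bnd
      (λ s j j' ej ej' → P.subst₂ (λ x y → M s x ≈ M s y) (FinP.toℕ-injective (P.sym ej))
          (FinP.toℕ-injective (P.trans (P.trans e (P.cong suc (ℕ.+-identityʳ (toℕ a)))) (P.sym ej'))) (h s))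
    where
    bnd : suc (toℕ a) ℕ.< r
    bnd = P.subst (ℕ._< r) (P.trans e (P.cong suc (ℕ.+-identityʳ (toℕ a)))) (FinP.toℕ<n b)
  det-equalAt (suc d) r M a b e h = begin
      det r M ≈⟨ sym (-‿involutive _) ⟩
      - (- det r M) ≈⟨ -‿cong (sym (det-swapAdj r M M' p bnd (λ s t t' et → reflexive (P.cong (M s) (FinP.toℕ-injective (P.trans (toℕ-swapAdjFin p bnd t) (P.sym et))))))) ⟩
      - det r M' ≈⟨ -‿≈0 (det-equalAt d r M' a bm ebm (λ s → trans (reflexive (P.cong (M s) swa)) (trans (h s) (reflexive (P.cong (M s) (P.sym swb)))))) ⟩
      0# ∎
    where
    p : ℕ
    p = suc (toℕ a ℕ.+ d)
    e' : toℕ b ≡ suc p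
    e' = P.trans e (P.cong suc (ℕ.+-suc (toℕ a) d))
    bnd : suc p ℕ.< r
    bnd = P.subst (ℕ._< r) e' (FinP.toℕ<n b)
    M' : Mat r
    M' s t = M s (swapAdjFin p bnd t)
    bm : Fin r
    bm = Fin.fromℕ< (ℕ.<-trans (ℕ.n<1+n p) bnd)
    ebm : toℕ bm ≡ suc (toℕ a ℕ.+ d)
    ebm = FinP.toℕ-fromℕ< _
    a<p : toℕ a ℕ.< p
    a<p = ℕ.s≤s (ℕ.m≤m+n (toℕ a) d)
    swa : swapAdjFin p bnd a ≡ a
    swa = FinP.toℕ-injective (P.trans (toℕ-swapAdjFin p bnd a) (swapAdjℕ-other p (toℕ a) (ℕ.<⇒≢ a<p) (ℕ.<⇒≢ (ℕ.<-trans a<p (ℕ.n<1+n p)))))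
    swb : swapAdjFin p bnd bm ≡ b
    swb = FinP.toℕ-injective (P.trans (toℕ-swapAdjFin p bnd bm) (P.trans (P.cong (swapAdjℕ p) ebm) (P.trans (swapAdjℕ-self p) (P.sym e'))))

  det-equalColumns : ∀ r (M : Mat r) a b → a ≢ b → (∀ s → M s a ≈ M s b) → det r M ≈ 0#
  det-equalColumns r M a b a≢b h with ℕ.<-cmp (toℕ a) (toℕ b)
  ... | tri< lt _ _ = det-equalAt (toℕ b ℕ.∸ suc (toℕ a)) r M a b (P.sym (ℕ.m+[n∸m]≡n lt)) h
  ... | tri≈ _ eq _ = ⊥-elim (a≢b (FinP.toℕ-injective eq))
  ... | tri> _ _ gt = det-equalAt (toℕ a ℕ.∸ suc (toℕ b)) r M b a (P.sym (ℕ.m+[n∸m]≡n gt)) (λ s → sym (h s))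

  replaceColumn : ∀ {r} → Mat r → Fin r → (Fin r → Carrier) → Mat r
  replaceColumn M l v s t with t Fin.≟ l
  ... | yes _ = v s
  ... | no _ = M s t

  replaceColumn-at : ∀ {r} (M : Mat r) l v s → replaceColumn M l v s l ≈ v s
  replaceColumn-at M l v s with l Fin.≟ l
  ... | yes _ = refl
  ... | no n = ⊥-elim (n P.refl)

  replaceColumn-off : ∀ {r} (M : Mat r) l v s t → t ≢ l → replaceColumn M l v s t ≈ M s t
  replaceColumn-off M l v s t ne with t Fin.≟ l
  ... | yes e = ⊥-elim (ne e)
  ... | no _ = refl

  det-addColumn : ∀ r (M N : Mat r) l c μ → l ≢ c → (∀ s → N s l ≈ M s l + μ * M s c) →
              (∀ s t → t ≢ l → N s t ≈ M s t) → det r N ≈ det r M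
  det-addColumn r M N l c μ l≢c hl ho = begin
    det r N ≈⟨ det-linear r N M N2 l μ (λ s → trans (hl s) (+-congˡ (*-congˡ (sym (replaceColumn-at M l _ s))))) ho
                 (λ s t ne → trans (ho s t ne) (sym (replaceColumn-off M l _ s t ne))) ⟩
    det r M + μ * det r N2 ≈⟨ +-congˡ (*≈0ʳ (det-equalColumns r N2 l c l≢c (λ s → trans (replaceColumn-at M l _ s) (sym (replaceColumn-off M l _ s c (λ e → l≢c (P.sym e))))))) ⟩
    det r M + 0# ≈⟨ +-identityʳ _ ⟩
    det r M ∎
    where
    N2 : Mat _
    N2 = replaceColumn M l (λ s → M s c)

  addColumnBelow : ∀ {r} → Mat r → Fin r → (Fin r → Carrier) → ℕ → Mat r
  addColumnBelow M c lam p s t with toℕ t ℕ.<? p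
  ... | yes _ = M s t + lam t * M s c
  ... | no _ = M s t

  addColumnBelow-pivot : ∀ {r} (M : Mat r) c lam p s → lam c ≈ 0# → addColumnBelow M c lam p s c ≈ M s c
  addColumnBelow-pivot M c lam p s z with toℕ c ℕ.<? p
  ... | yes _ = trans (+-congˡ (*≈0ˡ z)) (+-identityʳ _)
  ... | no _ = refl

  det-addColumnBelow : ∀ r (M : Mat r) c lam → lam c ≈ 0# → ∀ p → p ℕ.≤ r → det r (addColumnBelow M c lam p) ≈ det r M
  det-addColumnBelow r M c lam z zero _ = det-cong r (λ s t → base s t)
    where
    base : ∀ s t → addColumnBelow M c lam 0 s t ≈ M s t
    base s t with toℕ t ℕ.<? 0
    ... | yes ()
    ... | no _ = refl
  det-addColumnBelow r M c lam z (suc p) b = trans step (det-addColumnBelow r M c lam z p (ℕ.<⇒≤ b))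
    where
    tp : Fin r
    tp = Fin.fromℕ< b
    etp : toℕ tp ≡ p
    etp = FinP.toℕ-fromℕ< b
    off : ∀ s t → t ≢ tp → addColumnBelow M c lam (suc p) s t ≈ addColumnBelow M c lam p s t
    off s t ne with toℕ t ℕ.<? suc p | toℕ t ℕ.<? p
    ... | yes _ | yes _ = refl
    ... | no _ | no _ = refl
    ... | yes a | no a' = ⊥-elim (ne (FinP.toℕ-injective (P.trans (ℕ.≤-antisym (ℕ.s≤s⁻¹ a) (ℕ.≮⇒≥ a')) (P.sym etp))))
    ... | no a | yes a' = ⊥-elim (a (ℕ.m<n⇒m<1+n a'))
    at : ∀ s → addColumnBelow M c lam (suc p) s tp ≈ addColumnBelow M c lam p s tp + lam tp * addColumnBelow M c lam p s c
    at s with toℕ tp ℕ.<? suc p | toℕ tp ℕ.<? p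
    ... | yes _ | no _ = +-congˡ (*-congˡ (sym (addColumnBelow-pivot M c lam p s z)))
    ... | _ | yes a' = ⊥-elim (ℕ.<-irrefl etp a')
    ... | no a | no _ = ⊥-elim (a (P.subst (ℕ._< suc p) (P.sym etp) (ℕ.n<1+n p)))
    step : det r (addColumnBelow M c lam (suc p)) ≈ det r (addColumnBelow M c lam p)
    step with tp Fin.≟ c
    ... | no ne = det-addColumn r (addColumnBelow M c lam p) (addColumnBelow M c lam (suc p)) tp c (lam tp) ne at off
    ... | yes P.refl = det-cong r (λ s t → eqq s t)
      where
      eqq : ∀ s t → addColumnBelow M c lam (suc p) s t ≈ addColumnBelow M c lam p s t
      eqq s t with t Fin.≟ tp
      ... | no ne = off s t ne
      ... | yes P.refl = trans (at s) (trans (+-congˡ (*≈0ˡ z)) (+-identityʳ _))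

  det-addColumnToAll : ∀ r (M N : Mat r) c (lam : Fin r → Carrier) → lam c ≈ 0# →
               (∀ s t → N s t ≈ M s t + lam t * M s c) → det r N ≈ det r M
  det-addColumnToAll r M N c lam z h = trans (det-cong r full) (det-addColumnBelow r M c lam z r ℕ.≤-refl)
    where
    full : ∀ s t → N s t ≈ addColumnBelow M c lam r s t
    full s t with toℕ t ℕ.<? r
    ... | yes _ = h s t
    ... | no a = ⊥-elim (a (FinP.toℕ<n t))

  leftKernel-addColumn : ∀ r (M : Mat r) (u : Fin r → Carrier) c (lam : Fin r → Carrier) →
    (∀ l → sumF r (λ s → u s * M s l) ≈ 0#) → ∀ t → sumF r (λ s → u s * (M s t + lam t * M s c)) ≈ 0#
  leftKernel-addColumn r M u c lam h t = begin
    sumF r (λ s → u s * (M s t + lam t * M s c))         ≈⟨ sumF-cong r (λ s → trans (distribˡ (u s) (M s t) (lam t * M s c)) (+-congˡ (x*yz≈y*xz (u s) (lam t) (M s c)))) ⟩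
    sumF r (λ s → u s * M s t + lam t * (u s * M s c))   ≈⟨ sumF-+ r (λ s → u s * M s t) (λ s → lam t * (u s * M s c)) ⟩
    sumF r (λ s → u s * M s t) + sumF r (λ s → lam t * (u s * M s c)) ≈⟨ +-cong (h t) (sym (*-distribˡ-sumF r (lam t) (λ s → u s * M s c))) ⟩
    0# + lam t * sumF r (λ s → u s * M s c)             ≈⟨ +≈0 refl (*≈0ʳ (h c)) ⟩
    0#                                                  ∎

  module _ (_≟_ : Decidable _≈_) where
    -- If u₀ ≉ 0, clear row 0 by column operations against a nonzero pivot M₀c;
    -- the tail of u is then a left-kernel vector of the minor at c.
    det-leftKernel : ∀ r (M : Mat r) (u : Fin r → Carrier) → (∀ l → sumF r (λ s → u s * M s l) ≈ 0#) →
         ∃ (λ s → ¬ (u s ≈ 0#)) → det r M ≈ 0#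
    det-leftKernel zero M u h (() , _)
    det-leftKernel (suc r) M u h (s , us) with u Fin.zero ≟ 0#
    ... | yes u0 = sumF-zero (suc r) {λ j → alt (toℕ j) (M Fin.zero j * det r (minor M j))} (λ j → alt-zero (toℕ j) (*≈0ʳ (det-leftKernel r (minor M j) (u ∘ Fin.suc)
            (λ t → +-cancel-zeroˡ (*≈0ˡ u0) (h (punchIn j t))) (wit s us))))
      where
      wit : ∀ s → ¬ (u s ≈ 0#) → ∃ (λ s' → ¬ (u (Fin.suc s') ≈ 0#))
      wit Fin.zero n = ⊥-elim (n u0)
      wit (Fin.suc s') n = s' , n
    ... | no u0 with FinP.all? (λ j → M Fin.zero j ≟ 0#)
    ...   | yes allz = sumF-zero (suc r) {λ j → alt (toℕ j) (M Fin.zero j * det r (minor M j))} (λ j → alt-zero (toℕ j) (*≈0ˡ (allz j)))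
    ...   | no nall with FinP.¬∀⟶∃¬ (suc r) (λ j → M Fin.zero j ≈ 0#) (λ j → M Fin.zero j ≟ 0#) nall
    ...     | (c , Mc) with inverse (M Fin.zero c) Mc
    ...       | (w , cw) = trans (sym (det-addColumnToAll (suc r) M N c lam lam-c (λ s t → refl))) detN
      where
      lam : Fin (suc r) → Carrier
      lam t with t Fin.≟ c
      ... | yes _ = 0#
      ... | no _ = - (M Fin.zero t * w)
      lam-c : lam c ≈ 0#
      lam-c with c Fin.≟ c
      ... | yes _ = refl
      ... | no n = ⊥-elim (n P.refl)
      N : Mat (suc r)
      N s t = M s t + lam t * M s c
      N0 : ∀ t → t ≢ c → N Fin.zero t ≈ 0#
      N0 t ne with t Fin.≟ c
      ... | yes e = ⊥-elim (ne e)
      ... | no _ = begin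
        M Fin.zero t + - (M Fin.zero t * w) * M Fin.zero c ≈⟨ +-congˡ (sym (-‿distribˡ-* _ _)) ⟩
        M Fin.zero t + - ((M Fin.zero t * w) * M Fin.zero c) ≈⟨ +-congˡ (-‿cong (trans (*-assoc _ _ _) (trans (*-congˡ (trans (*-comm w _) cw)) (*-identityʳ _)))) ⟩
        M Fin.zero t + - M Fin.zero t ≈⟨ -‿inverseʳ _ ⟩
        0# ∎
      Nc : ∀ s → N s c ≈ M s c
      Nc s = trans (+-congˡ (*≈0ˡ lam-c)) (+-identityʳ _)
      kerN : ∀ t → sumF (suc r) (λ s → u s * N s t) ≈ 0#
      kerN = leftKernel-addColumn (suc r) M u c lam h
      Dc : det r (minor N c) ≈ 0#
      Dc with FinP.all? (λ s' → u (Fin.suc s') ≟ 0#)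
      ... | yes allz = ⊥-elim (*-nonzero u0 Mc (begin
          u Fin.zero * M Fin.zero c ≈⟨ *-congˡ (sym (Nc Fin.zero)) ⟩
          u Fin.zero * N Fin.zero c ≈⟨ sym (+-identityʳ _) ⟩
          u Fin.zero * N Fin.zero c + 0# ≈⟨ +-congˡ (sym (sumF-zero r {λ s' → u (Fin.suc s') * N (Fin.suc s') c} (λ s' → *≈0ˡ (allz s')))) ⟩
          sumF (suc r) (λ s → u s * N s c) ≈⟨ kerN c ⟩
          0# ∎))
      ... | no nz = det-leftKernel r (minor N c) (u ∘ Fin.suc)
              (λ t → +-cancel-zeroˡ (*≈0ʳ (N0 (punchIn c t) (FinP.punchInᵢ≢i c t))) (kerN (punchIn c t)))
              (FinP.¬∀⟶∃¬ r (λ s' → u (Fin.suc s') ≈ 0#) (λ s' → u (Fin.suc s') ≟ 0#) nz)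
      detN : det (suc r) N ≈ 0#
      detN = begin
        det (suc r) N ≈⟨ sumF-single (suc r) (λ j → alt (toℕ j) (N Fin.zero j * det r (minor N j))) c (λ j ne → alt-zero (toℕ j) (*≈0ˡ (N0 j ne))) ⟩
        alt (toℕ c) (N Fin.zero c * det r (minor N c)) ≈⟨ alt-zero (toℕ c) (*≈0ʳ Dc) ⟩
        0# ∎

  alt-parity : ∀ pj po s l t x → (pj ℕ.+ po ≡ suc (l ℕ.+ t)) ⊎ (suc (pj ℕ.+ po) ≡ l ℕ.+ t) →
            alt (pj ℕ.+ (s ℕ.+ po)) x ≈ alt ((suc s ℕ.+ l) ℕ.+ t) x
  alt-parity pj po s l t x c = trans (alt-≡ x e0) (cs c)
    where
    e0 : pj ℕ.+ (s ℕ.+ po) ≡ s ℕ.+ (pj ℕ.+ po)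
    e0 = P.trans (P.sym (ℕ.+-assoc pj s po)) (P.trans (P.cong (ℕ._+ po) (ℕ.+-comm pj s)) (ℕ.+-assoc s pj po))
    eB : (suc s ℕ.+ l) ℕ.+ t ≡ suc (s ℕ.+ (l ℕ.+ t))
    eB = P.cong suc (ℕ.+-assoc s l t)
    cs : (pj ℕ.+ po ≡ suc (l ℕ.+ t)) ⊎ (suc (pj ℕ.+ po) ≡ l ℕ.+ t) → alt (s ℕ.+ (pj ℕ.+ po)) x ≈ alt ((suc s ℕ.+ l) ℕ.+ t) x
    cs (inj₁ e) = alt-≡ x (P.trans (P.cong (s ℕ.+_) e) (P.trans (ℕ.+-suc s (l ℕ.+ t)) (P.sym eB)))
    cs (inj₂ e) = trans (sym (alt-suc-suc (s ℕ.+ (pj ℕ.+ po)) x)) (alt-≡ x (P.sym (P.trans eB (P.cong suc (P.trans (P.cong (s ℕ.+_) (P.sym e)) (ℕ.+-suc s _))))))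

  det-unitColumn : ∀ r (M : Mat (suc r)) (s0 l0 : Fin (suc r)) → M s0 l0 ≈ 1# → (∀ s → s ≢ s0 → M s l0 ≈ 0#) →
                det (suc r) M ≈ alt (toℕ s0 ℕ.+ toℕ l0) (det r (λ s t → M (punchIn s0 s) (punchIn l0 t)))
  det-unitColumn r M Fin.zero l0 h1 h0 = begin
      det (suc r) M ≈⟨ sumF-single (suc r) (λ j → alt (toℕ j) (M Fin.zero j * det r (minor M j))) l0 off ⟩
      alt (toℕ l0) (M Fin.zero l0 * det r (minor M l0)) ≈⟨ alt-cong (toℕ l0) (trans (*-congʳ h1) (*-identityˡ _)) ⟩
      alt (toℕ l0) (det r (minor M l0)) ∎
    where
    off : ∀ j → j ≢ l0 → alt (toℕ j) (M Fin.zero j * det r (minor M j)) ≈ 0#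
    off j ne = alt-zero (toℕ j) (*≈0ʳ (det-zeroColumn r (minor M j) (punchOut ne)
      (λ s → trans (reflexive (P.cong (M (Fin.suc s)) (FinP.punchIn-punchOut ne))) (h0 (Fin.suc s) (λ ())))))
  det-unitColumn (suc r) M (Fin.suc s0) l0 h1 h0 = begin
      det (suc (suc r)) M ≈⟨ sumF-remove (suc r) f l0 ⟩
      f l0 + sumF (suc r) (f ∘ punchIn l0) ≈⟨ +0' (alt-zero (toℕ l0) (*≈0ˡ (h0 Fin.zero (λ ())))) ⟩
      sumF (suc r) (f ∘ punchIn l0) ≈⟨ sumF-cong (suc r) term ⟩
      sumF (suc r) (λ t → alt E (alt (toℕ t) (M Fin.zero (punchIn l0 t) * det r (minor X t)))) ≈⟨ sym (alt-sumF E (suc r) (λ t → alt (toℕ t) (M Fin.zero (punchIn l0 t) * det r (minor X t)))) ⟩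
      alt E (det (suc r) X) ∎
    where
    f : Fin (suc (suc r)) → Carrier
    f j = alt (toℕ j) (M Fin.zero j * det (suc r) (minor M j))
    E : ℕ
    E = toℕ (Fin.suc s0) ℕ.+ toℕ l0
    X : Mat (suc r)
    X s t = M (punchIn (Fin.suc s0) s) (punchIn l0 t)
    +0' : ∀ {a b} → a ≈ 0# → a + b ≈ b
    +0' {a} {b} a0 = trans (+-congʳ a0) (+-identityˡ b)
    term : ∀ t → f (punchIn l0 t) ≈ alt E (alt (toℕ t) (M Fin.zero (punchIn l0 t) * det r (minor X t)))
    term t = begin
        alt (toℕ j) (M Fin.zero j * det (suc r) (minor M j))
          ≈⟨ alt-cong (toℕ j) (*-congˡ (det-unitColumn r (minor M j) s0 l0'
               (trans (reflexive (P.cong (M (Fin.suc s0)) (FinP.punchIn-punchOut jne))) h1)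
               (λ s ne → trans (reflexive (P.cong (M (Fin.suc s)) (FinP.punchIn-punchOut jne))) (h0 (Fin.suc s) (λ e → ne (FinP.suc-injective e)))))) ⟩
        alt (toℕ j) (M Fin.zero j * alt (toℕ s0 ℕ.+ toℕ l0') (det r Y))
          ≈⟨ alt-cong (toℕ j) (sym (alt-*ʳ (toℕ s0 ℕ.+ toℕ l0') (M Fin.zero j) (det r Y))) ⟩
        alt (toℕ j) (alt (toℕ s0 ℕ.+ toℕ l0') (M Fin.zero j * det r Y))
          ≈⟨ sym (alt-+ℕ (toℕ j) _ _) ⟩
        alt (toℕ j ℕ.+ (toℕ s0 ℕ.+ toℕ l0')) (M Fin.zero j * det r Y)
          ≈⟨ alt-≡ _ (P.cong₂ (λ a b → a ℕ.+ (toℕ s0 ℕ.+ b)) ej el0') ⟩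
        alt (punchInℕ (toℕ l0) (toℕ t) ℕ.+ (toℕ s0 ℕ.+ punchOutℕ (punchInℕ (toℕ l0) (toℕ t)) (toℕ l0))) (M Fin.zero j * det r Y)
          ≈⟨ alt-parity (punchInℕ (toℕ l0) (toℕ t)) (punchOutℕ (punchInℕ (toℕ l0) (toℕ t)) (toℕ l0)) (toℕ s0) (toℕ l0) (toℕ t) (M Fin.zero j * det r Y) (punchInℕ-punchOutℕ-parity (toℕ l0) (toℕ t)) ⟩
        alt (E ℕ.+ toℕ t) (M Fin.zero j * det r Y)
          ≈⟨ alt-+ℕ E (toℕ t) _ ⟩
        alt E (alt (toℕ t) (M Fin.zero j * det r Y))
          ≈⟨ alt-cong E (alt-cong (toℕ t) (*-congˡ (det-cong r YZ))) ⟩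
        alt E (alt (toℕ t) (M Fin.zero (punchIn l0 t) * det r (minor X t))) ∎
      where
      j : Fin (suc (suc r))
      j = punchIn l0 t
      jne : j ≢ l0
      jne = FinP.punchInᵢ≢i l0 t
      l0' : Fin (suc r)
      l0' = punchOut jne
      ej : toℕ j ≡ punchInℕ (toℕ l0) (toℕ t)
      ej = toℕ-punchIn l0 t
      el0' : toℕ l0' ≡ punchOutℕ (punchInℕ (toℕ l0) (toℕ t)) (toℕ l0)
      el0' = P.trans (toℕ-punchOut jne) (P.cong (λ z → punchOutℕ z (toℕ l0)) ej)
      Y : Mat r
      Y a b = M (Fin.suc (punchIn s0 a)) (punchIn j (punchIn l0' b))
      YZ : ∀ a b → Y a b ≈ minor X t a b
      YZ a b = reflexive (P.cong (M (Fin.suc (punchIn s0 a))) (FinP.toℕ-injective (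
        P.trans (toℕ-punchIn j (punchIn l0' b))
        (P.trans (P.cong₂ punchInℕ ej (P.trans (toℕ-punchIn l0' b) (P.cong (λ z → punchInℕ z (toℕ b)) el0')))
        (P.trans (punchInℕ-punchOutℕ-comm (toℕ l0) (toℕ t) (toℕ b))
        (P.sym (P.trans (toℕ-punchIn l0 (punchIn t b)) (P.cong (punchInℕ (toℕ l0)) (toℕ-punchIn t b)))))))))


module FieldHomProperties {c ℓ c' ℓ'} (F : Field c ℓ) (K : Field c' ℓ')
                          (ι : Field.Carrier F → Field.Carrier K) (hom : IsFieldHom F K ι) where
  private
    module F = Field F
    module FO = FieldOps F
  open Field K
  open FieldOps K
  open FieldSums K
  open IsFieldHom hom public using (ι-cong; ι-+; ι-*; ι-0; ι-1)

  ι-neg : ∀ a → ι (F.- a) ≈ - ι a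
  ι-neg a = +-inverseˡ-unique _ _ (trans (sym (ι-+ (F.- a) a)) (trans (ι-cong (F.-‿inverseˡ a)) ι-0))

  ι-sub : ∀ x y → ι (x F.+ F.- y) ≈ ι x + - ι y
  ι-sub x y = trans (ι-+ _ _) (+-congˡ (ι-neg y))

  ι-sumF : ∀ r (f : Fin r → F.Carrier) → ι (FO.sumF r f) ≈ sumF r (ι ∘ f)
  ι-sumF zero f = ι-0
  ι-sumF (suc r) f = trans (ι-+ _ _) (+-congˡ (ι-sumF r (f ∘ Fin.suc)))

  ι-neg-1 : ∀ x → ι (F.- F.1#) * x ≈ - x
  ι-neg-1 x = trans (*-congʳ (trans (ι-neg F.1#) (-‿cong ι-1))) (-1*x≈-x x)

module BetaExpansion {c ℓ c' ℓ'} (F : Field c ℓ) (K : Field c' ℓ')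
                     (ι : Field.Carrier F → Field.Carrier K) (hom : IsFieldHom F K ι)
                     (β : Field.Carrier K) where
  private
    module F = Field F
    module FO = FieldOps F
    module FS = FieldSums F
  open Field K
  open FieldOps K
  open FieldSums K
  open Determinants K
  open FieldHomProperties F K ι hom
  open import Relation.Binary.Reasoning.Setoid setoid

  pow-+ : ∀ a b → pow β (a ℕ.+ b) ≈ pow β a * pow β b
  pow-+ zero b = sym (*-identityˡ _)
  pow-+ (suc a) b = trans (*-congˡ (pow-+ a b)) (sym (*-assoc _ _ _))

  pow-≡ : ∀ {a b} → a ≡ b → pow β a ≈ pow β b
  pow-≡ P.refl = refl

  data BetaSpan (lo : ℕ) : ℕ → Carrier → Set (c ⊔ c' ⊔ ℓ') where
    none : ∀ {x} → x ≈ 0# → BetaSpan lo 0 x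
    snoc : ∀ {w x} (y : Carrier) (a : F.Carrier) → BetaSpan lo w y → x ≈ y + ι a * pow β (lo ℕ.+ w) → BetaSpan lo (suc w) x

  span-cong : ∀ {lo w x x'} → BetaSpan lo w x → x ≈ x' → BetaSpan lo w x'
  span-cong (none p) e = none (trans (sym e) p)
  span-cong (snoc y a s p) e = snoc y a s (trans (sym e) p)

  span-zero : ∀ lo w → BetaSpan lo w 0#
  span-zero lo zero = none refl
  span-zero lo (suc w) = snoc 0# F.0# (span-zero lo w) (sym (trans (+-identityˡ _) (*≈0ˡ ι-0)))

  span-+ : ∀ {lo w x y} → BetaSpan lo w x → BetaSpan lo w y → BetaSpan lo w (x + y)
  span-+ (none p) (none q) = none (+≈0 p q)
  span-+ {lo} {suc w} (snoc y a s p) (snoc y' a' s' p') = snoc (y + y') (a F.+ a') (span-+ s s')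
    (trans (+-cong p p') (trans (+-interchange _ _ _ _) (+-congˡ (trans (sym (distribʳ _ _ _)) (*-congʳ (sym (ι-+ a a')))))))

  span-ι : ∀ {lo w x} a → BetaSpan lo w x → BetaSpan lo w (ι a * x)
  span-ι a (none p) = none (*≈0ʳ p)
  span-ι a (snoc y b s p) = snoc (ι a * y) (a F.* b) (span-ι a s)
    (trans (*-congˡ p) (trans (distribˡ _ _ _) (+-congˡ (trans (sym (*-assoc _ _ _)) (*-congʳ (sym (ι-* a b)))))))

  span-suc : ∀ {lo w x} → BetaSpan lo w x → BetaSpan lo (suc w) x
  span-suc {lo} {w} {x} s = snoc x F.0# s (sym (trans (+-congˡ (*≈0ˡ ι-0)) (+-identityʳ x)))

  span-monomial : ∀ lo w a e → lo ℕ.≤ e → e ℕ.< lo ℕ.+ w → BetaSpan lo w (ι a * pow β e)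
  span-monomial lo zero a e le lt = ⊥-elim (ℕ.<-irrefl P.refl (ℕ.<-≤-trans lt (P.subst (ℕ._≤ e) (P.sym (ℕ.+-identityʳ lo)) le)))
  span-monomial lo (suc w) a e le lt with e ℕ.≟ lo ℕ.+ w
  ... | yes eq = snoc 0# a (span-zero lo w) (sym (trans (+-identityˡ _) (*-congˡ (pow-≡ (P.sym eq)))))
  ... | no ne = span-suc (span-monomial lo w a e le (ℕ.≤∧≢⇒< (ℕ.s≤s⁻¹ (P.subst (e ℕ.<_) (ℕ.+-suc lo w) lt)) ne))

  span-embed : ∀ {lo w x} lo' w' → BetaSpan lo w x → lo' ℕ.≤ lo → lo ℕ.+ w ℕ.≤ lo' ℕ.+ w' → BetaSpan lo' w' x
  span-embed lo' w' (none p) _ _ = span-cong (span-zero lo' w') (sym p)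
  span-embed {lo} {suc w} lo' w' (snoc y a s p) l1 l2 =
    span-cong (span-+ (span-embed lo' w' s l1 (ℕ.≤-trans (ℕ.+-monoʳ-≤ lo (ℕ.n≤1+n w)) l2))
                      (span-monomial lo' w' a (lo ℕ.+ w) (ℕ.≤-trans l1 (ℕ.m≤m+n lo w)) (P.subst (ℕ._≤ lo' ℕ.+ w') (ℕ.+-suc lo w) l2)))
              (sym p)

  span-pow-* : ∀ {lo w x} d → BetaSpan lo w x → BetaSpan (d ℕ.+ lo) w (pow β d * x)
  span-pow-* d (none p) = none (*≈0ʳ p)
  span-pow-* {lo} {suc w} d (snoc y a s p) = snoc (pow β d * y) a (span-pow-* d s)
    (trans (*-congˡ p) (trans (distribˡ _ _ _) (+-congˡ (trans (x*yz≈y*xz _ _ _)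
      (*-congˡ (trans (sym (pow-+ d (lo ℕ.+ w))) (pow-≡ (P.sym (ℕ.+-assoc d lo w)))))))))

  span-* : ∀ {l1 w1 x l2 w2 y} → BetaSpan l1 w1 x → BetaSpan l2 w2 y → BetaSpan (l1 ℕ.+ l2) (w1 ℕ.+ w2) (x * y)
  span-* {l1} {_} {x} {l2} {w2} {y} (none p) sy = span-cong (span-zero _ _) (sym (*≈0ˡ p))
  span-* {l1} {suc w1} {x} {l2} {w2} {y} (snoc y' a s p) sy =
    span-cong (span-+ (span-embed (l1 ℕ.+ l2) (suc w1 ℕ.+ w2) (span-* s sy) ℕ.≤-refl (ℕ.+-monoʳ-≤ (l1 ℕ.+ l2) (ℕ.n≤1+n _)))
                      (span-embed (l1 ℕ.+ l2) (suc w1 ℕ.+ w2) (span-ι a (span-pow-* (l1 ℕ.+ w1) sy)) i1 i2))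
              (sym (trans (*-congʳ p) (trans (distribʳ _ _ _) (+-congˡ (*-assoc _ _ _)))))
    where
    i1 : l1 ℕ.+ l2 ℕ.≤ (l1 ℕ.+ w1) ℕ.+ l2
    i1 = ℕ.+-monoˡ-≤ l2 (ℕ.m≤m+n l1 w1)
    i2 : (l1 ℕ.+ w1) ℕ.+ l2 ℕ.+ w2 ℕ.≤ l1 ℕ.+ l2 ℕ.+ (suc w1 ℕ.+ w2)
    i2 = P.subst₂ ℕ._≤_ (eq l1 l2 w1 w2) (P.sym (ℕ.+-suc (l1 ℕ.+ l2) (w1 ℕ.+ w2))) (ℕ.n≤1+n _)
      where
      eq : ∀ a b c d → a ℕ.+ b ℕ.+ (c ℕ.+ d) ≡ a ℕ.+ c ℕ.+ b ℕ.+ d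
      eq = solve-∀

  span-embed-≡ : ∀ {lo w x} lo' w' → BetaSpan lo w x → lo' ℕ.≤ lo → lo ℕ.+ w ≡ lo' ℕ.+ w' → BetaSpan lo' w' x
  span-embed-≡ lo' w' s l e = span-embed lo' w' s l (ℕ.≤-reflexive e)

  HasTop : Carrier → ℕ → ℕ → F.Carrier → Set (c ⊔ c' ⊔ ℓ')
  HasTop x lo w t = Σ Carrier (λ y → BetaSpan lo w y × (x ≈ y + ι t * pow β (lo ℕ.+ w)))

  top-cong : ∀ {x x' lo w t t'} → HasTop x lo w t → x ≈ x' → t F.≈ t' → HasTop x' lo w t'
  top-cong (y , s , e) ex et = y , s , trans (sym ex) (trans e (+-congˡ (*-congʳ (ι-cong et))))

  top-zero : ∀ lo w → HasTop 0# lo w F.0#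
  top-zero lo w = 0# , span-zero lo w , sym (trans (+-identityˡ _) (*≈0ˡ ι-0))

  top-+ : ∀ {x y lo w t t'} → HasTop x lo w t → HasTop y lo w t' → HasTop (x + y) lo w (t F.+ t')
  top-+ (y1 , s1 , e1) (y2 , s2 , e2) = y1 + y2 , span-+ s1 s2 ,
    trans (+-cong e1 e2) (trans (+-interchange _ _ _ _) (+-congˡ (trans (sym (distribʳ _ _ _)) (*-congʳ (sym (ι-+ _ _))))))

  top-ι : ∀ {x lo w t} a → HasTop x lo w t → HasTop (ι a * x) lo w (a F.* t)
  top-ι a (y , s , e) = ι a * y , span-ι a s ,
    trans (*-congˡ e) (trans (distribˡ _ _ _) (+-congˡ (trans (sym (*-assoc _ _ _)) (*-congʳ (sym (ι-* _ _))))))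

  top-lift : ∀ {x lo w t} w' → w ℕ.< w' → HasTop x lo w t → HasTop x lo w' F.0#
  top-lift {x} {lo} {w} {t} w' lt (y , s , e) = x ,
    span-cong (span-+ (span-embed lo w' s ℕ.≤-refl (ℕ.+-monoʳ-≤ lo (ℕ.<⇒≤ lt)))
                      (span-monomial lo w' t (lo ℕ.+ w) (ℕ.m≤m+n lo w) (ℕ.+-monoʳ-< lo lt))) (sym e) ,
    sym (trans (+-congˡ (*≈0ˡ ι-0)) (+-identityʳ x))

  top-* : ∀ {x y l1 w1 t1 l2 w2 t2} → HasTop x l1 w1 t1 → HasTop y l2 w2 t2 → HasTop (x * y) (l1 ℕ.+ l2) (w1 ℕ.+ w2) (t1 F.* t2)
  top-* {x} {y} {l1} {w1} {t1} {l2} {w2} {t2} (y1 , s1 , e1) (y2 , s2 , e2) =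
    (y1 * y2 + (y1 * B + A * y2)) ,
    span-+ (span-* s1 s2) (span-+ (span-cong (span-embed-≡ (l1 ℕ.+ l2) (w1 ℕ.+ w2) (span-ι t2 (span-pow-* (l2 ℕ.+ w2) s1)) i1 (eq1 l1 l2 w1 w2)) c1)
                                  (span-cong (span-embed-≡ (l1 ℕ.+ l2) (w1 ℕ.+ w2) (span-ι t1 (span-pow-* (l1 ℕ.+ w1) s2)) i2 (eq2 l1 l2 w1 w2)) c2)) ,
    main
    where
    A B : Carrier
    A = ι t1 * pow β (l1 ℕ.+ w1)
    B = ι t2 * pow β (l2 ℕ.+ w2)
    i1 : l1 ℕ.+ l2 ℕ.≤ l2 ℕ.+ w2 ℕ.+ l1
    i1 = ℕ.≤-trans (ℕ.≤-reflexive (ℕ.+-comm l1 l2)) (ℕ.+-monoˡ-≤ l1 (ℕ.m≤m+n l2 w2))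
    i2 : l1 ℕ.+ l2 ℕ.≤ l1 ℕ.+ w1 ℕ.+ l2
    i2 = ℕ.+-monoˡ-≤ l2 (ℕ.m≤m+n l1 w1)
    eq1 : ∀ l1 l2 w1 w2 → l2 ℕ.+ w2 ℕ.+ l1 ℕ.+ w1 ≡ l1 ℕ.+ l2 ℕ.+ (w1 ℕ.+ w2)
    eq1 = solve-∀
    eq2 : ∀ l1 l2 w1 w2 → l1 ℕ.+ w1 ℕ.+ l2 ℕ.+ w2 ≡ l1 ℕ.+ l2 ℕ.+ (w1 ℕ.+ w2)
    eq2 = solve-∀
    c1 : ι t2 * (pow β (l2 ℕ.+ w2) * y1) ≈ y1 * B
    c1 = trans (sym (*-assoc _ _ _)) (*-comm _ _)
    c2 : ι t1 * (pow β (l1 ℕ.+ w1) * y2) ≈ A * y2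
    c2 = sym (*-assoc _ _ _)
    eq3 : ∀ l1 l2 w1 w2 → l1 ℕ.+ w1 ℕ.+ (l2 ℕ.+ w2) ≡ l1 ℕ.+ l2 ℕ.+ (w1 ℕ.+ w2)
    eq3 = solve-∀
    AB : A * B ≈ ι (t1 F.* t2) * pow β (l1 ℕ.+ l2 ℕ.+ (w1 ℕ.+ w2))
    AB = begin
      (ι t1 * pow β (l1 ℕ.+ w1)) * (ι t2 * pow β (l2 ℕ.+ w2)) ≈⟨ *-assoc _ _ _ ⟩
      ι t1 * (pow β (l1 ℕ.+ w1) * (ι t2 * pow β (l2 ℕ.+ w2))) ≈⟨ *-congˡ (x*yz≈y*xz _ _ _) ⟩
      ι t1 * (ι t2 * (pow β (l1 ℕ.+ w1) * pow β (l2 ℕ.+ w2))) ≈⟨ sym (*-assoc _ _ _) ⟩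
      (ι t1 * ι t2) * (pow β (l1 ℕ.+ w1) * pow β (l2 ℕ.+ w2)) ≈⟨ *-cong (sym (ι-* t1 t2)) (trans (sym (pow-+ (l1 ℕ.+ w1) (l2 ℕ.+ w2))) (pow-≡ (eq3 l1 l2 w1 w2))) ⟩
      ι (t1 F.* t2) * pow β (l1 ℕ.+ l2 ℕ.+ (w1 ℕ.+ w2)) ∎
    main : x * y ≈ (y1 * y2 + (y1 * B + A * y2)) + ι (t1 F.* t2) * pow β (l1 ℕ.+ l2 ℕ.+ (w1 ℕ.+ w2))
    main = begin
      x * y ≈⟨ *-cong e1 e2 ⟩
      (y1 + A) * (y2 + B) ≈⟨ distribʳ _ _ _ ⟩
      y1 * (y2 + B) + A * (y2 + B) ≈⟨ +-cong (distribˡ _ _ _) (distribˡ _ _ _) ⟩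
      (y1 * y2 + y1 * B) + (A * y2 + A * B) ≈⟨ sym (+-assoc _ _ _) ⟩
      ((y1 * y2 + y1 * B) + A * y2) + A * B ≈⟨ +-cong (+-assoc _ _ _) AB ⟩
      (y1 * y2 + (y1 * B + A * y2)) + ι (t1 F.* t2) * pow β (l1 ℕ.+ l2 ℕ.+ (w1 ℕ.+ w2)) ∎

  -- Leading x lo hi t : x is an F-combination of β^lo, …, β^hi whose coefficient
  -- of β^hi is t (and x = t = 0 when hi < lo).  Only when hi − lo < m does this
  -- determine t, see leading-unique.
  Leading : Carrier → ℕ → ℕ → F.Carrier → Set (c ⊔ ℓ ⊔ c' ⊔ ℓ')
  Leading x lo hi t = (lo ℕ.≤ hi → HasTop x lo (hi ∸ lo) t) × (hi ℕ.< lo → (x ≈ 0#) × (t F.≈ F.0#))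

  leading-cong : ∀ {x x' lo hi t t'} → Leading x lo hi t → x ≈ x' → t F.≈ t' → Leading x' lo hi t'
  leading-cong (q1 , q2) ex et = (λ le → top-cong (q1 le) ex et) ,
    (λ lt → trans (sym ex) (proj₁ (q2 lt)) , F.trans (F.sym et) (proj₂ (q2 lt)))

  leading-≡ : ∀ {x lo hi lo' hi' t} → lo ≡ lo' → hi ≡ hi' → Leading x lo hi t → Leading x lo' hi' t
  leading-≡ P.refl P.refl q = q

  leading-zero : ∀ {x lo hi t} → x ≈ 0# → t F.≈ F.0# → Leading x lo hi t
  leading-zero {x} {lo} {hi} {t} x0 t0 = (λ _ → top-cong (top-zero lo (hi ∸ lo)) (sym x0) (F.sym t0)) , (λ _ → x0 , t0)

  leading-+ : ∀ {x y lo hi t t'} → Leading x lo hi t → Leading y lo hi t' → Leading (x + y) lo hi (t F.+ t')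
  leading-+ (a1 , a2) (b1 , b2) = (λ le → top-+ (a1 le) (b1 le)) ,
    (λ lt → +≈0 (proj₁ (a2 lt)) (proj₁ (b2 lt)) , F.trans (F.+-cong (proj₂ (a2 lt)) (proj₂ (b2 lt))) (F.+-identityˡ F.0#))

  leading-ι : ∀ {x lo hi t} a → Leading x lo hi t → Leading (ι a * x) lo hi (a F.* t)
  leading-ι a (q1 , q2) = (λ le → top-ι a (q1 le)) , (λ lt → *≈0ʳ (proj₁ (q2 lt)) , FS.*≈0ʳ (proj₂ (q2 lt)))

  leading-neg : ∀ {x lo hi t} → Leading x lo hi t → Leading (- x) lo hi (F.- t)
  leading-neg {x} {lo} {hi} {t} q = leading-cong (leading-ι (F.- F.1#) q)
    (ι-neg-1 x) (FS.-1*x≈-x t)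

  leading-lift : ∀ {x lo h t} h' → h ℕ.< h' → Leading x lo h t → Leading x lo h' F.0#
  leading-lift {x} {lo} {h} {t} h' lt (q1 , q2) with lo ℕ.≤? h
  ... | yes le = (λ le' → top-lift (h' ∸ lo) (ℕ.∸-monoˡ-< lt le) (q1 le)) ,
                 (λ lt' → ⊥-elim (ℕ.<-irrefl P.refl (ℕ.<-≤-trans lt' (ℕ.≤-trans le (ℕ.<⇒≤ lt)))))
  ... | no nle = leading-zero (proj₁ (q2 (ℕ.≰⇒> nle))) F.refl

  leading-* : ∀ {x y l1 h1 t1 l2 h2 t2} → Leading x l1 h1 t1 → Leading y l2 h2 t2 → Leading (x * y) (l1 ℕ.+ l2) (h1 ℕ.+ h2) (t1 F.* t2)
  leading-* {x} {y} {l1} {h1} {t1} {l2} {h2} {t2} (a1 , a2) (b1 , b2) with l1 ℕ.≤? h1 | l2 ℕ.≤? h2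
  ... | yes p | yes q = (λ _ → P.subst (λ w → HasTop (x * y) (l1 ℕ.+ l2) w (t1 F.* t2)) (P.sym (∸-distrib-+ p q)) (top-* (a1 p) (b1 q))) ,
                        (λ lt → ⊥-elim (ℕ.<-irrefl P.refl (ℕ.<-≤-trans lt (ℕ.+-mono-≤ p q))))
  ... | no np | _ = leading-zero (*≈0ˡ (proj₁ (a2 (ℕ.≰⇒> np)))) (FS.*≈0ˡ (proj₂ (a2 (ℕ.≰⇒> np))))
  ... | _ | no nq = leading-zero (*≈0ʳ (proj₁ (b2 (ℕ.≰⇒> nq)))) (FS.*≈0ʳ (proj₂ (b2 (ℕ.≰⇒> nq))))

  leading-sumF : ∀ {lo hi} n (f : Fin n → Carrier) (ts : Fin n → F.Carrier) → (∀ i → Leading (f i) lo hi (ts i)) → Leading (sumF n f) lo hi (FO.sumF n ts)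
  leading-sumF zero f ts h = leading-zero refl F.refl
  leading-sumF (suc n) f ts h = leading-+ (h Fin.zero) (leading-sumF n (f ∘ Fin.suc) (ts ∘ Fin.suc) (h ∘ Fin.suc))

  leading-alt : ∀ {x lo hi t} e → Leading x lo hi t → Leading (alt e x) lo hi (FO.alt e t)
  leading-alt zero q = q
  leading-alt (suc e) q = leading-neg (leading-alt e q)

  leading-one : Leading 1# 0 0 F.1#
  leading-one = (λ _ → 0# , none refl , sym (trans (+-identityˡ _) (trans (*-identityʳ _) ι-1))) , (λ ())

  leading-det : ∀ r (M : Mat r) (T : Fin r → Fin r → F.Carrier) (Lr Lc Hr Hc : Fin r → ℕ) →
          (∀ s t → Leading (M s t) (Lr s ℕ.+ Lc t) (Hr s ℕ.+ Hc t) (T s t)) →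
          Leading (det r M) (sumℕ r Lr ℕ.+ sumℕ r Lc) (sumℕ r Hr ℕ.+ sumℕ r Hc) (FO.det r T)
  leading-det zero M T Lr Lc Hr Hc h = leading-one
  leading-det (suc r) M T Lr Lc Hr Hc h = leading-sumF (suc r) _ _ (λ j → leading-alt (toℕ j)
      (leading-≡ (ix Lr Lc j) (ix Hr Hc j)
        (leading-* (h Fin.zero j) (leading-det r (minor M j) (λ s t → T (Fin.suc s) (punchIn j t))
              (Lr ∘ Fin.suc) (Lc ∘ punchIn j) (Hr ∘ Fin.suc) (Hc ∘ punchIn j)
              (λ s t → h (Fin.suc s) (punchIn j t))))))
    where
    e : ∀ a b c d → a ℕ.+ b ℕ.+ (c ℕ.+ d) ≡ a ℕ.+ c ℕ.+ (b ℕ.+ d)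
    e = solve-∀
    ix : ∀ (L L' : Fin (suc r) → ℕ) j → L Fin.zero ℕ.+ L' j ℕ.+ (sumℕ r (L ∘ Fin.suc) ℕ.+ sumℕ r (L' ∘ punchIn j)) ≡ sumℕ (suc r) L ℕ.+ sumℕ (suc r) L'
    ix L L' j = P.trans (e (L Fin.zero) (L' j) _ _) (P.cong (sumℕ (suc r) L ℕ.+_) (P.sym (ℕSum.sum-remove {i = j} L')))

  pow-nonzero : ¬ (β ≈ 0#) → ∀ e → ¬ (pow β e ≈ 0#)
  pow-nonzero nb zero p = 0≉1 (sym p)
  pow-nonzero nb (suc e) = *-nonzero nb (pow-nonzero nb e)

  span-factor : ∀ {lo w y} → BetaSpan lo w y → Σ Carrier (λ y' → BetaSpan 0 w y' × (y ≈ pow β lo * y'))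
  span-factor (none p) = 0# , none refl , trans p (sym (zeroʳ _))
  span-factor {lo} {suc w} {y} (snoc y'' a s e) with span-factor s
  ... | (y3 , s3 , e3) = (y3 + ι a * pow β w) , snoc y3 a s3 refl ,
    (begin
      y ≈⟨ e ⟩
      y'' + ι a * pow β (lo ℕ.+ w) ≈⟨ +-cong e3 (*-congˡ (pow-+ lo w)) ⟩
      pow β lo * y3 + ι a * (pow β lo * pow β w) ≈⟨ +-congˡ (x*yz≈y*xz _ _ _) ⟩
      pow β lo * y3 + pow β lo * (ι a * pow β w) ≈⟨ sym (distribˡ _ _ _) ⟩
      pow β lo * (y3 + ι a * pow β w) ∎)

  leading-monomial : ∀ x e lo → lo ℕ.≤ e → Leading (ι x * pow β e) lo e x
  leading-monomial x e lo le = (λ _ → 0# , span-zero lo (e ∸ lo) , sym (trans (+-identityˡ _) (*-congˡ (pow-≡ (ℕ.m+[n∸m]≡n le))))) ,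
                      (λ lt → ⊥-elim (ℕ.<-irrefl P.refl (ℕ.<-≤-trans lt le)))

  pow-*-monomial : ∀ i x e → pow β i * (ι x * pow β e) ≈ ι x * pow β (i ℕ.+ e)
  pow-*-monomial i x e = trans (x*yz≈y*xz _ _ _) (*-congˡ (sym (pow-+ i e)))

  module PowerBasisCoordinates {m : ℕ} (B : PowerBasis F K ι m β) where
    open PowerBasis B using (coord; expand; indep)

    unitCoord : ℕ → F.Carrier → Fin m → F.Carrier
    unitCoord w a e with toℕ e ℕ.≟ w
    ... | yes _ = a
    ... | no _ = F.0#

    unitCoord-off : ∀ w a e → toℕ e ≢ w → unitCoord w a e F.≈ F.0#
    unitCoord-off w a e ne with toℕ e ℕ.≟ w
    ... | yes p = ⊥-elim (ne p)
    ... | no _ = F.refl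

    unitCoord-on : ∀ w a e → toℕ e ≡ w → unitCoord w a e F.≈ a
    unitCoord-on w a e eq with toℕ e ℕ.≟ w
    ... | yes _ = F.refl
    ... | no ne = ⊥-elim (ne eq)

    sumF-unitCoord : ∀ w a → w ℕ.< m → sumF m (λ e → ι (unitCoord w a e) * pow β (toℕ e)) ≈ ι a * pow β w
    sumF-unitCoord w a lt = trans (sumF-single m _ wF (λ e ne → *≈0ˡ (trans (ι-cong (unitCoord-off w a e (λ q → ne (FinP.toℕ-injective (P.trans q (P.sym ewF)))))) ι-0)))
                         (*-cong (ι-cong (unitCoord-on w a wF ewF)) (pow-≡ ewF))
      where
      wF : Fin m
      wF = Fin.fromℕ< lt
      ewF : toℕ wF ≡ w
      ewF = FinP.toℕ-fromℕ< lt

    Represents : Carrier → (Fin m → F.Carrier) → Set ℓ'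
    Represents y cf = y ≈ sumF m (λ e → ι (cf e) * pow β (toℕ e))

    represents-+ : ∀ {y cf} w a → w ℕ.< m → Represents y cf → Represents (y + ι a * pow β w) (λ e → cf e F.+ unitCoord w a e)
    represents-+ {y} {cf} w a lt r = begin
      y + ι a * pow β w ≈⟨ +-cong r (sym (sumF-unitCoord w a lt)) ⟩
      sumF m (λ e → ι (cf e) * pow β (toℕ e)) + sumF m (λ e → ι (unitCoord w a e) * pow β (toℕ e)) ≈⟨ sym (sumF-+ m _ _) ⟩
      sumF m (λ e → ι (cf e) * pow β (toℕ e) + ι (unitCoord w a e) * pow β (toℕ e)) ≈⟨ sumF-cong m (λ e → trans (sym (distribʳ _ _ _)) (*-congʳ (sym (ι-+ _ _)))) ⟩
      sumF m (λ e → ι (cf e F.+ unitCoord w a e) * pow β (toℕ e)) ∎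

    span-coords : ∀ {w y} → BetaSpan 0 w y → w ℕ.≤ m → Σ (Fin m → F.Carrier) λ cf → Represents y cf × (∀ e → w ℕ.≤ toℕ e → cf e F.≈ F.0#)
    span-coords (none p) _ = (λ _ → F.0#) , trans p (sym (sumF-zero m (λ e → *≈0ˡ ι-0))) , (λ _ _ → F.refl)
    span-coords {suc w} {y} (snoc y' a s e) le with span-coords s (ℕ.<⇒≤ le)
    ... | (cf , r , z) = (λ e → cf e F.+ unitCoord w a e) , trans e (represents-+ w a le r) ,
      (λ e' le' → F.trans (F.+-cong (z e' (ℕ.<⇒≤ le')) (unitCoord-off w a e' (λ q → ℕ.<-irrefl (P.sym q) le'))) (F.+-identityˡ F.0#))

    top-unique : ∀ {x w t} → HasTop x 0 w t → x ≈ 0# → w ℕ.< m → t F.≈ F.0#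
    top-unique {x} {w} {t} (y , s , e) x0 lt with span-coords s (ℕ.<⇒≤ lt)
    ... | (cf , r , z) = F.trans (F.sym (F.+-identityˡ t))
          (F.trans (F.+-congʳ (F.sym (z wF wle)))
            (F.trans (F.+-congˡ (F.sym (unitCoord-on w t wF ewF))) (indep _ (trans (sym (represents-+ w t lt r)) (trans (sym e) x0)) wF)))
      where
      wF : Fin m
      wF = Fin.fromℕ< lt
      ewF : toℕ wF ≡ w
      ewF = FinP.toℕ-fromℕ< lt
      wle : w ℕ.≤ toℕ wF
      wle = ℕ.≤-reflexive (P.sym ewF)

    leading-unique : ∀ {x lo hi t} → ¬ (β ≈ 0#) → Leading x lo hi t → x ≈ 0# → hi ∸ lo ℕ.< m → t F.≈ F.0#
    leading-unique {x} {lo} {hi} {t} nb (q1 , q2) x0 lt with lo ℕ.≤? hi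
    ... | no nle = proj₂ (q2 (ℕ.≰⇒> nle))
    ... | yes le with q1 le
    ...   | (y , s , e) with span-factor s
    ...     | (y' , s' , e') = top-unique (y' , s' , refl) z0 lt
      where
      w = hi ∸ lo
      z0 : y' + ι t * pow β w ≈ 0#
      z0 = *-cancel-zeroˡ (pow-nonzero nb lo) (begin
        pow β lo * (y' + ι t * pow β w) ≈⟨ distribˡ _ _ _ ⟩
        pow β lo * y' + pow β lo * (ι t * pow β w) ≈⟨ +-cong (sym e') (trans (x*yz≈y*xz _ _ _) (*-congˡ (sym (pow-+ lo w)))) ⟩
        y + ι t * pow β (lo ℕ.+ w) ≈⟨ sym e ⟩
        x ≈⟨ x0 ⟩
        0# ∎)

    ≈-dec : Decidable F._≈_ → Decidable _≈_
    ≈-dec _≈?_ x y with FinP.all? (λ i → coord x i ≈? coord y i)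
    ... | yes eq = yes (trans (expand x) (trans (sumF-cong m (λ i → *-congʳ (ι-cong (eq i)))) (sym (expand y))))
    ... | no neq = no (λ xy → neq (λ i → F.trans (F.sym (F.+-identityʳ _)) (F.trans (F.+-congˡ (F.sym (F.-‿inverseˡ (coord y i))))
           (F.trans (F.sym (F.+-assoc _ _ _)) (F.trans (F.+-congʳ (indep _ (diff xy) i)) (F.+-identityˡ _))))))
      where
      diff : x ≈ y → sumF m (λ i → ι (coord x i F.+ F.- coord y i) * pow β (toℕ i)) ≈ 0#
      diff xy = begin
        sumF m (λ i → ι (coord x i F.+ F.- coord y i) * pow β (toℕ i))
          ≈⟨ sumF-cong m (λ i → trans (*-congʳ (ι-sub _ _)) (trans (distribʳ _ _ _) (+-congˡ (sym (-‿distribˡ-* _ _))))) ⟩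
        sumF m (λ i → ι (coord x i) * pow β (toℕ i) + - (ι (coord y i) * pow β (toℕ i)))
          ≈⟨ sumF-+ m _ _ ⟩
        sumF m (λ i → ι (coord x i) * pow β (toℕ i)) + sumF m (λ i → - (ι (coord y i) * pow β (toℕ i)))
          ≈⟨ +-cong (sym (expand x)) (trans (sym (-‿sumF m _)) (-‿cong (sym (expand y)))) ⟩
        x + - y ≈⟨ +-congʳ xy ⟩
        y + - y ≈⟨ -‿inverseʳ y ⟩
        0# ∎

    β-nonzero : 2 ℕ.≤ m → ¬ (β ≈ 0#)
    β-nonzero 2≤m β≈0 = F.0≉1 (F.sym (F.trans (F.sym (unitCoord-on 1 F.1# one (FinP.toℕ-fromℕ< 2≤m))) (indep _ vanish one)))
      where
      one : Fin m
      one = Fin.fromℕ< 2≤m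
      vanish : sumF m (λ e → ι (unitCoord 1 F.1# e) * pow β (toℕ e)) ≈ 0#
      vanish = trans (sumF-unitCoord 1 F.1# 2≤m) (trans (*-congʳ ι-1) (trans (*-identityˡ _) (trans (*-identityʳ β) β≈0)))

module PrefixSpan {c ℓ c' ℓ'} (F : Field c ℓ) (K : Field c' ℓ')
                  (ι : Field.Carrier F → Field.Carrier K) (hom : IsFieldHom F K ι)
                  (v : ℕ → Field.Carrier K) where
  private
    module F = Field F
  open Field K
  open FieldOps K
  open FieldSums K
  open FieldHomProperties F K ι hom
  open import Relation.Binary.Reasoning.Setoid setoid

  InPrefixSpan : ℕ → Carrier → Set (c ⊔ ℓ')
  InPrefixSpan j y = Σ (Fin j → F.Carrier) (λ x → y ≈ sumF j (λ b → ι (x b) * v (toℕ b)))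

  Redundant : ℕ → Set (c ⊔ ℓ')
  Redundant j = InPrefixSpan j (v j)

  prefixSpan-cong : ∀ {j y y'} → InPrefixSpan j y → y ≈ y' → InPrefixSpan j y'
  prefixSpan-cong (x , e) e' = x , trans (sym e') e

  prefixSpan-zero : ∀ j → InPrefixSpan j 0#
  prefixSpan-zero j = (λ _ → F.0#) , sym (sumF-zero j (λ b → *≈0ˡ ι-0))

  prefixSpan-+ : ∀ {j y y'} → InPrefixSpan j y → InPrefixSpan j y' → InPrefixSpan j (y + y')
  prefixSpan-+ {j} (x , e) (x' , e') = (λ b → x b F.+ x' b) ,
    trans (+-cong e e') (trans (sym (sumF-+ j _ _)) (sumF-cong j (λ b → trans (sym (distribʳ _ _ _)) (*-congʳ (sym (ι-+ _ _))))))

  prefixSpan-ι : ∀ {j y} w → InPrefixSpan j y → InPrefixSpan j (ι w * y)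
  prefixSpan-ι {j} w (x , e) = (λ b → w F.* x b) ,
    trans (*-congˡ e) (trans (*-distribˡ-sumF j _ _) (sumF-cong j (λ b → trans (sym (*-assoc _ _ _)) (*-congʳ (sym (ι-* _ _))))))

  prefixSpan-v : ∀ j b → b ℕ.< j → InPrefixSpan j (v b)
  prefixSpan-v j b lt = x , sym (trans (sumF-single j _ bF off) (trans (*-congʳ (trans (ι-cong (xon bF ebF)) ι-1)) (trans (*-identityˡ _) (reflexive (P.cong v ebF)))))
    where
    bF : Fin j
    bF = Fin.fromℕ< lt
    ebF : toℕ bF ≡ b
    ebF = FinP.toℕ-fromℕ< lt
    x : Fin j → F.Carrier
    x e with toℕ e ℕ.≟ b
    ... | yes _ = F.1#
    ... | no _ = F.0#
    xon : ∀ e → toℕ e ≡ b → x e F.≈ F.1#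
    xon e eq with toℕ e ℕ.≟ b
    ... | yes _ = F.refl
    ... | no ne = ⊥-elim (ne eq)
    off : ∀ e → e ≢ bF → ι (x e) * v (toℕ e) ≈ 0#
    off e ne with toℕ e ℕ.≟ b
    ... | yes eq = ⊥-elim (ne (FinP.toℕ-injective (P.trans eq (P.sym ebF))))
    ... | no _ = *≈0ˡ ι-0

  prefixSpan-sumF : ∀ j d (σ : Fin d → ℕ) (cs : Fin d → F.Carrier) → (∀ t → σ t ℕ.< j) →
             InPrefixSpan j (sumF d (λ t → ι (cs t) * v (σ t)))
  prefixSpan-sumF j zero σ cs b = prefixSpan-zero j
  prefixSpan-sumF j (suc d) σ cs b = prefixSpan-+ (prefixSpan-ι (cs Fin.zero) (prefixSpan-v j (σ Fin.zero) (b Fin.zero)))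
                                    (prefixSpan-sumF j d (σ ∘ Fin.suc) (cs ∘ Fin.suc) (b ∘ Fin.suc))

  module _ {q} (FF : FiniteField F q) (_≟_ : Decidable _≈_) where
    open FiniteField FF using (enum; enum-sur)

    prefixSpan? : ∀ j y → Dec (InPrefixSpan j y)
    prefixSpan? j y with ∃-function? j (λ f → y ≈ sumF j (λ b → ι (enum (f b)) * v (toℕ b)))
                      (λ f g e p → trans p (sumF-cong j (λ b → reflexive (P.cong (λ z → ι (enum z) * v (toℕ b)) (e b)))))
                      (λ f → y ≟ sumF j (λ b → ι (enum (f b)) * v (toℕ b)))
    ... | yes (f , p) = yes (enum ∘ f , p)
    ... | no np = no (λ { (x , e) → np ((λ b → proj₁ (enum-sur (x b))) ,
                     trans e (sumF-cong j (λ b → *-congʳ (ι-cong (proj₂ (enum-sur (x b))))))) })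

    redundant? : ∀ j → Dec (Redundant j)
    redundant? j = prefixSpan? j (v j)

  -- A nonzero last coefficient would make the last position redundant.
  nonRedundant-independent : Decidable F._≈_ → ∀ d (σ : Fin d → ℕ) → Increasing σ → (∀ t → ¬ Redundant (σ t)) → ∀ (cs : Fin d → F.Carrier) →
             sumF d (λ t → ι (cs t) * v (σ t)) ≈ 0# → ∀ t → cs t F.≈ F.0#
  nonRedundant-independent _≈?_ (suc d) σ sm nr cs z t with cs (Fin.fromℕ d) ≈? F.0#
  ... | no cl = ⊥-elim (nr last (prefixSpan-cong (prefixSpan-ι w (prefixSpan-ι (F.- F.1#) (prefixSpan-sumF (σ last) d (σ ∘ punchIn last) (cs ∘ punchIn last) lessL))) eqX))
    where
    last : Fin (suc d)
    last = Fin.fromℕ d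
    lessL : ∀ t → σ (punchIn last t) ℕ.< σ last
    lessL t = sm (punchIn last t) last (P.subst₂ ℕ._<_ (P.sym (P.trans (toℕ-punchIn last t) (P.trans (P.cong (λ z → punchInℕ z (toℕ t)) (FinP.toℕ-fromℕ d)) (punchInℕ-below d (toℕ t) (FinP.toℕ<n t))))) (P.sym (FinP.toℕ-fromℕ d)) (FinP.toℕ<n t))
    w : F.Carrier
    w = proj₁ (F.inverse (cs last) cl)
    cw : cs last F.* w F.≈ F.1#
    cw = proj₂ (F.inverse (cs last) cl)
    R : Carrier
    R = sumF d (λ t → ι (cs (punchIn last t)) * v (σ (punchIn last t)))
    split0 : ι (cs last) * v (σ last) + R ≈ 0#
    split0 = trans (sym (sumF-remove d (λ t → ι (cs t) * v (σ t)) last)) z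
    eqX : ι w * (ι (F.- F.1#) * R) ≈ v (σ last)
    eqX = begin
      ι w * (ι (F.- F.1#) * R) ≈⟨ *-congˡ (ι-neg-1 R) ⟩
      ι w * (- R) ≈⟨ *-congˡ (sym (+-inverseˡ-unique _ _ split0)) ⟩
      ι w * (ι (cs last) * v (σ last)) ≈⟨ sym (*-assoc _ _ _) ⟩
      (ι w * ι (cs last)) * v (σ last) ≈⟨ *-congʳ (trans (sym (ι-* _ _)) (trans (ι-cong (F.trans (F.*-comm _ _) cw)) ι-1)) ⟩
      1# * v (σ last) ≈⟨ *-identityˡ _ ⟩
      v (σ last) ∎
  ... | yes cl with t Fin.≟ Fin.fromℕ d
  ...   | yes P.refl = cl
  ...   | no ne = P.subst (λ z → cs z F.≈ F.0#) (FinP.punchIn-punchOut (λ e → ne (P.sym e)))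
                   (nonRedundant-independent _≈?_ d (σ ∘ punchIn last) (increasing-punchIn last sm) (nr ∘ punchIn last) (cs ∘ punchIn last)
                     (+-cancel-zeroˡ (*≈0ˡ (trans (ι-cong cl) ι-0)) (trans (sym (sumF-remove d (λ t → ι (cs t) * v (σ t)) last)) z)) (punchOut (λ e → ne (P.sym e))))
    where
    last : Fin (suc d)
    last = Fin.fromℕ d

module Lemma33 {c ℓ c' ℓ'} (F : Field c ℓ) (K : Field c' ℓ') {q m : ℕ} (n δ : ℕ)
               (FF : FiniteField F q)
               (ι : Field.Carrier F → Field.Carrier K) (hom : IsFieldHom F K ι)
               (β : Field.Carrier K) (B : PowerBasis F K ι m β)
               (δ≥1 : 1 ℕ.≤ δ) (δ≤n : δ ℕ.≤ n)
               (bnd : kOf n δ ℕ.* n ∸ kOf n δ ℕ.* kOf n δ ℕ.+ 2 ℕ.≤ m)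
               (a : ℕ → ℕ → Field.Carrier F) where
  module F = Field F
  module FO = FieldOps F
  module FS = FieldSums F
  module FD = Determinants F
  open Field K
  open FieldOps K
  open FieldSums K
  open Determinants K
  open BetaExpansion F K ι hom β
  open PowerBasisCoordinates B
  open FieldHomProperties F K ι hom
  open PowerBasis B using (coord; expand)
  open FiniteField FF using (_≈?_)
  open import Relation.Binary.Reasoning.Setoid setoid

  _≟K_ : Decidable _≈_
  _≟K_ = ≈-dec _≈?_

  k : ℕ
  k = kOf n δ

  entry : ℕ → ℕ → Carrier
  entry = gEntry F K ι β n k a

  G : Fin k → Fin n → Carrier
  G = gMatrix F K ι β n k a

  -- β^i G_{i,b} is an F-combination of β^i, …, β^{b+1+extraDegree i b} with top
  -- coefficient topCoeff i b; the extra degree comes from the entry a_{1,n-1} β^n.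
  topCoeff : ℕ → ℕ → F.Carrier
  topCoeff i b = if does (b ℕ.<? k) then (if does (b ℕ.≟ i ∸ 1) then F.1# else F.0#) else a i b

  extraDegree : ℕ → ℕ → ℕ
  extraDegree i b = if does (b ℕ.<? k) then 0 else (if does (suc b ℕ.<? n) then 0 else (if does (i ℕ.≟ 1) then 1 else 0))

  A-nonzero : Set ℓ
  A-nonzero = ∀ i j → 1 ℕ.≤ i → i ℕ.≤ k → k ℕ.≤ j → j ℕ.≤ n ∸ 1 → ¬ (a i j F.≈ F.0#)

  k≤n : k ℕ.≤ n
  k≤n = P.subst (ℕ._≤ n) (ℕ.+-comm 1 (n ∸ δ)) (P.subst (1 ℕ.+ (n ∸ δ) ℕ.≤_) (ℕ.m+[n∸m]≡n δ≤n) (ℕ.+-monoˡ-≤ (n ∸ δ) δ≥1))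

  leading-entry : ∀ i b → 1 ℕ.≤ i → i ℕ.≤ k → b ℕ.< n →
    Leading (pow β i * entry i b) i (suc b ℕ.+ extraDegree i b) (topCoeff i b)
  leading-entry i b 1≤i i≤k b<n with b ℕ.<ᵇ k in eb
  ... | true with b ℕ.≡ᵇ (i ∸ 1) in ee
  ...   | true = leading-≡ P.refl (P.sym (P.trans (P.cong (λ z → suc z ℕ.+ 0) e) (P.trans (ℕ.+-identityʳ _) (ℕ.suc-pred i {{ℕ.>-nonZero 1≤i}}))))
                    (leading-cong (leading-monomial F.1# i i ℕ.≤-refl) (trans (*-congʳ ι-1) (trans (*-identityˡ _) (sym (*-identityʳ _)))) F.refl)
    where
    e : b ≡ i ∸ 1
    e = ℕ.≡ᵇ⇒≡ b (i ∸ 1) (P.subst T (P.sym ee) tt)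
  ...   | false = leading-zero (zeroʳ _) F.refl
  leading-entry i b 1≤i i≤k b<n | false with suc b ℕ.<ᵇ n in esb
  ...   | true = leading-≡ P.refl (P.sym (ℕ.+-identityʳ (suc b)))
                    (leading-cong (leading-monomial (a i b) (suc b) i i≤sb) (sym (trans (pow-*-monomial i (a i b) (suc b ∸ i)) (*-congˡ (pow-≡ (ℕ.m+[n∸m]≡n i≤sb))))) F.refl)
    where
    b≮k : ¬ (b ℕ.< k)
    b≮k lt = P.subst T eb (ℕ.<⇒<ᵇ lt)
    i≤sb : i ℕ.≤ suc b
    i≤sb = ℕ.≤-trans i≤k (ℕ.≤-trans (ℕ.≮⇒≥ b≮k) (ℕ.n≤1+n b))
  ...   | false with i ℕ.≡ᵇ 1 in ei
  ...     | true = leading-≡ P.refl (P.trans (P.cong (ℕ._+ n) i1) (P.trans (ℕ.+-comm 1 n) (P.cong (ℕ._+ 1) (P.sym sbn))))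
                    (leading-cong (leading-monomial (a i b) (i ℕ.+ n) i (ℕ.m≤m+n i n)) (sym (pow-*-monomial i (a i b) n)) F.refl)
    where
    sb≮n : ¬ (suc b ℕ.< n)
    sb≮n lt = P.subst T esb (ℕ.<⇒<ᵇ lt)
    i1 : i ≡ 1
    i1 = ℕ.≡ᵇ⇒≡ i 1 (P.subst T (P.sym ei) tt)
    sbn : suc b ≡ n
    sbn = ℕ.≤-antisym b<n (ℕ.≮⇒≥ sb≮n)
  ...     | false = leading-≡ P.refl (P.sym (P.trans (ℕ.+-identityʳ (suc b)) sbn))
                    (leading-cong (leading-monomial (a i b) n i i≤n) (sym (trans (pow-*-monomial i (a i b) (n ∸ i)) (*-congˡ (pow-≡ (ℕ.m+[n∸m]≡n i≤n))))) F.refl)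
    where
    sb≮n : ¬ (suc b ℕ.< n)
    sb≮n lt = P.subst T esb (ℕ.<⇒<ᵇ lt)
    sbn : suc b ≡ n
    sbn = ℕ.≤-antisym b<n (ℕ.≮⇒≥ sb≮n)
    i≤n : i ℕ.≤ n
    i≤n = ℕ.≤-trans i≤k k≤n

  extraDegree-notLast : ∀ i b → suc b ℕ.< n → extraDegree i b ≡ 0
  extraDegree-notLast i b lt with b ℕ.<ᵇ k
  ... | true = P.refl
  ... | false with suc b ℕ.<ᵇ n in e
  ...   | true = P.refl
  ...   | false = ⊥-elim (P.subst T e (ℕ.<⇒<ᵇ lt))

  extraDegree-notFirst : ∀ i b → i ≢ 1 → extraDegree i b ≡ 0
  extraDegree-notFirst i b ne with b ℕ.<ᵇ k
  ... | true = P.refl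
  ... | false with suc b ℕ.<ᵇ n
  ...   | true = P.refl
  ...   | false with i ℕ.≡ᵇ 1 in e
  ...     | true = ⊥-elim (ne (ℕ.≡ᵇ⇒≡ i 1 (P.subst T (P.sym e) tt)))
  ...     | false = P.refl

  extraDegree-corner : ∀ b → k ℕ.≤ b → suc b ≡ n → extraDegree 1 b ≡ 1
  extraDegree-corner b kb sbn with b ℕ.<ᵇ k in e
  ... | true = ⊥-elim (ℕ.<-irrefl P.refl (ℕ.<-≤-trans (ℕ.<ᵇ⇒< b k (P.subst T (P.sym e) tt)) kb))
  ... | false with suc b ℕ.<ᵇ n in e2
  ...   | true = ⊥-elim (ℕ.<-irrefl sbn (ℕ.<ᵇ⇒< (suc b) n (P.subst T (P.sym e2) tt)))
  ...   | false = P.refl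

  topCoeff-diag : ∀ i b → b ℕ.< k → b ≡ i ∸ 1 → topCoeff i b F.≈ F.1#
  topCoeff-diag i b lt eq with b ℕ.<ᵇ k in e
  ... | false = ⊥-elim (P.subst T e (ℕ.<⇒<ᵇ lt))
  ... | true with b ℕ.≡ᵇ (i ∸ 1) in e2
  ...   | true = F.refl
  ...   | false = ⊥-elim (P.subst T e2 (ℕ.≡⇒≡ᵇ b (i ∸ 1) eq))

  topCoeff-offDiag : ∀ i b → b ℕ.< k → b ≢ i ∸ 1 → topCoeff i b F.≈ F.0#
  topCoeff-offDiag i b lt ne with b ℕ.<ᵇ k in e
  ... | false = ⊥-elim (P.subst T e (ℕ.<⇒<ᵇ lt))
  ... | true with b ℕ.≡ᵇ (i ∸ 1) in e2
  ...   | true = ⊥-elim (ne (ℕ.≡ᵇ⇒≡ b (i ∸ 1) (P.subst T (P.sym e2) tt)))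
  ...   | false = F.refl

  topCoeff-A : ∀ i b → k ℕ.≤ b → topCoeff i b F.≈ a i b
  topCoeff-A i b kb with b ℕ.<ᵇ k in e
  ... | true = ⊥-elim (ℕ.<-irrefl P.refl (ℕ.<-≤-trans (ℕ.<ᵇ⇒< b k (P.subst T (P.sym e) tt)) kb))
  ... | false = F.refl

  -- M_{i,τl} = G_{i,τl} − Σ_{b<τl} x_b G_{i,b} for a redundant position τl with
  -- c_τl = Σ_{b<τl} x_b c_b; u lies in the left kernel of such columns.
  reducedEntry : ∀ i τl → (Fin τl → F.Carrier) → Carrier
  reducedEntry i τl x = entry i τl + - sumF τl (λ b → ι (x b) * entry i (toℕ b))

  leading-reducedEntry : ∀ i τl (x : Fin τl → F.Carrier) e t → 1 ℕ.≤ i → i ℕ.≤ k → τl ℕ.< n →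
       Leading (pow β i * entry i τl) i (suc τl ℕ.+ e) t → Leading (pow β i * reducedEntry i τl x) i (suc τl ℕ.+ e) t
  leading-reducedEntry i τl x e t 1≤i i≤k τl<n hq =
    leading-cong (leading-+ hq (leading-neg (leading-sumF τl _ _ (λ b → leading-ι (x b) (sub b)))))
      (sym (trans (distribˡ _ _ _) (+-congˡ (trans (sym (-‿distribʳ-* _ _)) (-‿cong (trans (*-distribˡ-sumF τl _ _) (sumF-cong τl (λ b → x*yz≈y*xz _ _ _))))))))
      (F.trans (F.+-congˡ (F.trans (F.-‿cong (FS.sumF-zero τl (λ b → FS.*≈0ʳ F.refl))) FS.-0#≈0#)) (F.+-identityʳ t))
    where
    sub : ∀ (b : Fin τl) → Leading (pow β i * entry i (toℕ b)) i (suc τl ℕ.+ e) F.0#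
    sub b = leading-lift (suc τl ℕ.+ e) (ℕ.s≤s (ℕ.≤-trans (FinP.toℕ<n b) (ℕ.m≤m+n τl e)))
              (leading-≡ P.refl (P.trans (P.cong (suc (toℕ b) ℕ.+_) (extraDegree-notLast i (toℕ b) sbn)) (ℕ.+-identityʳ _))
                (leading-entry i (toℕ b) 1≤i i≤k (ℕ.<-trans (FinP.toℕ<n b) τl<n)))
      where
      sbn : suc (toℕ b) ℕ.< n
      sbn = ℕ.≤-<-trans (FinP.toℕ<n b) τl<n

  β≉0 : ¬ (β ≈ 0#)
  β≉0 = β-nonzero (ℕ.≤-trans (ℕ.m≤n+m 2 _) bnd)

  β⁻¹ : Carrier
  β⁻¹ = proj₁ (inverse β β≉0)
  ββ⁻¹≈1 : β * β⁻¹ ≈ 1#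
  ββ⁻¹≈1 = proj₂ (inverse β β≉0)

  pow-inverse : ∀ e → pow β⁻¹ e * pow β e ≈ 1#
  pow-inverse zero = *-identityˡ 1#
  pow-inverse (suc e) = begin
    (β⁻¹ * pow β⁻¹ e) * (β * pow β e) ≈⟨ *-assoc _ _ _ ⟩
    β⁻¹ * (pow β⁻¹ e * (β * pow β e)) ≈⟨ *-congˡ (x*yz≈y*xz _ _ _) ⟩
    β⁻¹ * (β * (pow β⁻¹ e * pow β e)) ≈⟨ sym (*-assoc _ _ _) ⟩
    (β⁻¹ * β) * (pow β⁻¹ e * pow β e) ≈⟨ *-cong (trans (*-comm _ _) ββ⁻¹≈1) (pow-inverse e) ⟩
    1# * 1# ≈⟨ *-identityˡ 1# ⟩
    1# ∎

  pow-inverse-nonzero : ∀ e → ¬ (pow β⁻¹ e ≈ 0#)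
  pow-inverse-nonzero e z = 0≉1 (trans (sym (*≈0ˡ z)) (pow-inverse e))

  -- The redundancy relations put (v_s β^{-ρ_s})_s in the left kernel of
  -- (β^{ρ_s} M_{s,l}), whose determinant has top coefficient det Tm in a window of
  -- fewer than m powers of β.
  reducedMatrix-contradiction : ∀ r (ρ τ es : Fin r → ℕ) (x : (l : Fin r) → Fin (τ l) → F.Carrier) (v : Fin r → Carrier)
           (Tm : Fin r → Fin r → F.Carrier) →
    ∃ (λ s → ¬ (v s ≈ 0#)) →
    (∀ l → sumF r (λ s → v s * entry (ρ s) (τ l)) ≈ sumF (τ l) (λ b → ι (x l b) * sumF r (λ s → v s * entry (ρ s) (toℕ b)))) →
    (∀ s l → Leading (pow β (ρ s) * reducedEntry (ρ s) (τ l) (x l)) (ρ s) (suc (τ l) ℕ.+ es s) (Tm s l)) →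
    (sumℕ r es ℕ.+ sumℕ r (suc ∘ τ)) ∸ sumℕ r ρ ℕ.< m →
    ¬ (FO.det r Tm F.≈ F.0#) → ⊥
  reducedMatrix-contradiction r ρ τ es x v Tm (s0 , vs0) rel hQ wid dT = dT (leading-unique β≉0 qdet detM0 wid')
    where
    M' : Mat r
    M' s l = pow β (ρ s) * reducedEntry (ρ s) (τ l) (x l)
    v' : Fin r → Carrier
    v' s = v s * pow β⁻¹ (ρ s)
    g : Fin r → ℕ → Carrier
    g s b = entry (ρ s) b
    ker : ∀ l → sumF r (λ s → v' s * M' s l) ≈ 0#
    ker l = begin
      sumF r (λ s → v' s * M' s l)
        ≈⟨ sumF-cong r (λ s → t1 s) ⟩
      sumF r (λ s → v s * g s (τ l) + - sumF (τ l) (λ b → ι (x l b) * (v s * g s (toℕ b))))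
        ≈⟨ sumF-+ r _ _ ⟩
      sumF r (λ s → v s * g s (τ l)) + sumF r (λ s → - sumF (τ l) (λ b → ι (x l b) * (v s * g s (toℕ b))))
        ≈⟨ +-congˡ (trans (sym (-‿sumF r _)) (-‿cong (trans (sumF-comm r (τ l) _) (sumF-cong (τ l) (λ b → sym (*-distribˡ-sumF r _ _)))))) ⟩
      sumF r (λ s → v s * g s (τ l)) + - sumF (τ l) (λ b → ι (x l b) * sumF r (λ s → v s * g s (toℕ b)))
        ≈⟨ +-congʳ (rel l) ⟩
      sumF (τ l) (λ b → ι (x l b) * sumF r (λ s → v s * g s (toℕ b))) + - sumF (τ l) (λ b → ι (x l b) * sumF r (λ s → v s * g s (toℕ b)))
        ≈⟨ -‿inverseʳ _ ⟩
      0# ∎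
      where
      t1 : ∀ s → v' s * M' s l ≈ v s * g s (τ l) + - sumF (τ l) (λ b → ι (x l b) * (v s * g s (toℕ b)))
      t1 s = begin
        (v s * pow β⁻¹ (ρ s)) * (pow β (ρ s) * reducedEntry (ρ s) (τ l) (x l)) ≈⟨ *-assoc _ _ _ ⟩
        v s * (pow β⁻¹ (ρ s) * (pow β (ρ s) * reducedEntry (ρ s) (τ l) (x l))) ≈⟨ *-congˡ (sym (*-assoc _ _ _)) ⟩
        v s * ((pow β⁻¹ (ρ s) * pow β (ρ s)) * reducedEntry (ρ s) (τ l) (x l)) ≈⟨ *-congˡ (trans (*-congʳ (pow-inverse (ρ s))) (*-identityˡ _)) ⟩
        v s * reducedEntry (ρ s) (τ l) (x l) ≈⟨ distribˡ _ _ _ ⟩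
        v s * g s (τ l) + v s * - sumF (τ l) (λ b → ι (x l b) * g s (toℕ b)) ≈⟨ +-congˡ (trans (sym (-‿distribʳ-* _ _)) (-‿cong (trans (*-distribˡ-sumF (τ l) _ _) (sumF-cong (τ l) (λ b → x*yz≈y*xz _ _ _))))) ⟩
        v s * g s (τ l) + - sumF (τ l) (λ b → ι (x l b) * (v s * g s (toℕ b))) ∎
    detM0 : det r M' ≈ 0#
    detM0 = det-leftKernel _≟K_ r M' v' ker (s0 , *-nonzero vs0 (pow-inverse-nonzero (ρ s0)))
    qdet : Leading (det r M') (sumℕ r ρ ℕ.+ sumℕ r (λ _ → 0)) (sumℕ r es ℕ.+ sumℕ r (suc ∘ τ)) (FO.det r Tm)
    qdet = leading-det r M' Tm ρ (λ _ → 0) es (suc ∘ τ)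
             (λ s l → leading-≡ (P.sym (ℕ.+-identityʳ (ρ s))) (ℕ.+-comm (suc (τ l)) (es s)) (hQ s l))
    wid' : (sumℕ r es ℕ.+ sumℕ r (suc ∘ τ)) ∸ (sumℕ r ρ ℕ.+ sumℕ r (λ _ → 0)) ℕ.< m
    wid' = P.subst (λ z → (sumℕ r es ℕ.+ sumℕ r (suc ∘ τ)) ∸ z ℕ.< m) (P.sym (P.trans (P.cong (sumℕ r ρ ℕ.+_) (sumℕ-zero r)) (ℕ.+-identityʳ _))) wid

  MinorsNonzero : ℕ → ℕ → Set ℓ
  MinorsNonzero rowMin colBound = ∀ r (ρ γ : Fin r → ℕ) → Increasing ρ → Increasing γ → (∀ s → (rowMin ℕ.≤ ρ s) × (ρ s ℕ.≤ k)) →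
                    (∀ t → (k ℕ.≤ γ t) × (γ t ℕ.< colBound)) → ¬ (FO.det r (λ s t → a (ρ s) (γ t)) F.≈ F.0#)

  -- A column τ_l < k of the top-coefficient matrix is the unit vector at the row
  -- with ρ_s = τ_l + 1; expanding all of them leaves a minor of A.
  topCoeffDet-nonzero : ∀ rowMin colBound → 1 ℕ.≤ rowMin → MinorsNonzero rowMin colBound → ∀ r (ρ τ : Fin r → ℕ) (Tm : Fin r → Fin r → F.Carrier) →
        Increasing ρ → Increasing τ → (∀ s → (rowMin ℕ.≤ ρ s) × (ρ s ℕ.≤ k)) → (∀ l → k ℕ.≤ τ l → τ l ℕ.< colBound) →
        (∀ l → τ l ℕ.< k → ∃ (λ s → ρ s ≡ suc (τ l))) → (∀ s l → Tm s l F.≈ topCoeff (ρ s) (τ l)) →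
        ¬ (FO.det r Tm F.≈ F.0#)
  topCoeffDet-nonzero rowMin colBound 1≤rowMin minors≉0 zero ρ τ Tm ρ-inc τ-inc ρ-range col-range unitRow Tm≈topCoeff d = F.0≉1 (F.sym d)
  topCoeffDet-nonzero rowMin colBound 1≤rowMin minors≉0 (suc r) ρ τ Tm ρ-inc τ-inc ρ-range col-range unitRow Tm≈topCoeff d with τ Fin.zero ℕ.<? k
  ... | yes lt = topCoeffDet-nonzero rowMin colBound 1≤rowMin minors≉0 r (ρ ∘ punchIn s0) (τ ∘ Fin.suc) T' (increasing-punchIn s0 ρ-inc) (increasing-suc τ-inc)
                   (ρ-range ∘ punchIn s0) (col-range ∘ Fin.suc) unitRow′ (λ s l → Tm≈topCoeff (punchIn s0 s) (Fin.suc l))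
                   (FS.alt-zero⁻¹ (toℕ s0 ℕ.+ 0) (F.trans (F.sym (FD.det-unitColumn r Tm s0 Fin.zero h1 h0)) d))
    where
    s0 : Fin (suc r)
    s0 = proj₁ (unitRow Fin.zero lt)
    es0 : ρ s0 ≡ suc (τ Fin.zero)
    es0 = proj₂ (unitRow Fin.zero lt)
    T' : Fin r → Fin r → F.Carrier
    T' s t = Tm (punchIn s0 s) (Fin.suc t)
    ρ≥1 : ∀ s → 1 ℕ.≤ ρ s
    ρ≥1 s = ℕ.≤-trans 1≤rowMin (proj₁ (ρ-range s))
    h1 : Tm s0 Fin.zero F.≈ F.1#
    h1 = F.trans (Tm≈topCoeff s0 Fin.zero) (topCoeff-diag (ρ s0) (τ Fin.zero) lt (P.sym (P.cong (ℕ._∸ 1) es0)))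
    h0 : ∀ s → s ≢ s0 → Tm s Fin.zero F.≈ F.0#
    h0 s ne = F.trans (Tm≈topCoeff s Fin.zero) (topCoeff-offDiag (ρ s) (τ Fin.zero) lt (λ e → ne (increasing-injective ρ-inc s s0
               (P.trans (P.sym (ℕ.suc-pred (ρ s) {{ℕ.>-nonZero (ρ≥1 s)}})) (P.trans (P.cong suc (P.sym e)) (P.sym es0))))))
    unitRow′ : ∀ l → τ (Fin.suc l) ℕ.< k → ∃ (λ s → ρ (punchIn s0 s) ≡ suc (τ (Fin.suc l)))
    unitRow′ l lt' with unitRow (Fin.suc l) lt'
    ... | (s , es) = punchOut s0≢s , P.trans (P.cong ρ (FinP.punchIn-punchOut s0≢s)) es
      where
      s0≢s : s0 ≢ s
      s0≢s e = ℕ.<-irrefl (ℕ.suc-injective (P.trans (P.sym es0) (P.trans (P.cong ρ e) es)))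
                 (τ-inc Fin.zero (Fin.suc l) (s≤s z≤n))
  ... | no nlt = minors≉0 (suc r) ρ τ ρ-inc τ-inc ρ-range (λ t → kτ t , col-range t (kτ t))
                   (F.trans (F.sym (FD.det-cong (suc r) (λ s t → F.trans (Tm≈topCoeff s t) (topCoeff-A (ρ s) (τ t) (kτ t))))) d)
    where
    kτ : ∀ t → k ℕ.≤ τ t
    kτ t = ℕ.≤-trans (ℕ.≮⇒≥ nlt) (increasing-zero τ-inc t)

  A1-minorsNonzero : A1MinorsNonzero F n k a → MinorsNonzero 1 (n ∸ 1)
  A1-minorsNonzero A1 r ρ γ ρ-inc γ-inc ρ-range col-range d = A1 r ρF γF smF smG
      (F.trans (FD.det-cong r (λ s t → F.reflexive (P.cong₂ a (eρ s) (eγ t)))) d)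
    where
    ρF : Fin r → Fin k
    ρF s = Fin.fromℕ< (ℕ.∸-monoˡ-< (s≤s (proj₂ (ρ-range s))) (proj₁ (ρ-range s)))
    γF : Fin r → Fin (n ∸ 1 ∸ k)
    γF t = Fin.fromℕ< (ℕ.∸-monoˡ-< (proj₂ (col-range t)) (proj₁ (col-range t)))
    eρ : ∀ s → suc (toℕ (ρF s)) ≡ ρ s
    eρ s = P.trans (P.cong suc (FinP.toℕ-fromℕ< _)) (ℕ.suc-pred (ρ s) {{ℕ.>-nonZero (proj₁ (ρ-range s))}})
    eγ : ∀ t → k ℕ.+ toℕ (γF t) ≡ γ t
    eγ t = P.trans (P.cong (k ℕ.+_) (FinP.toℕ-fromℕ< _)) (ℕ.m+[n∸m]≡n (proj₁ (col-range t)))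
    smF : StrictMono ρF
    smF x y lt = P.subst₂ ℕ._<_ (P.sym (FinP.toℕ-fromℕ< _)) (P.sym (FinP.toℕ-fromℕ< _)) (ℕ.∸-monoˡ-< (ρ-inc x y lt) (proj₁ (ρ-range x)))
    smG : StrictMono γF
    smG x y lt = P.subst₂ ℕ._<_ (P.sym (FinP.toℕ-fromℕ< _)) (P.sym (FinP.toℕ-fromℕ< _)) (ℕ.∸-monoˡ-< (γ-inc x y lt) (proj₁ (col-range x)))

  A2-minorsNonzero : A2MinorsNonzero F n k a → MinorsNonzero 2 n
  A2-minorsNonzero A2 r ρ γ ρ-inc γ-inc ρ-range col-range d = A2 r ρF γF smF smG
      (F.trans (FD.det-cong r (λ s t → F.reflexive (P.cong₂ a (eρ s) (eγ t)))) d)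
    where
    ρF : Fin r → Fin (k ∸ 1)
    ρF s = Fin.fromℕ< (ℕ.∸-monoˡ-< (s≤s (proj₂ (ρ-range s))) (proj₁ (ρ-range s)))
    γF : Fin r → Fin (n ∸ k)
    γF t = Fin.fromℕ< (ℕ.∸-monoˡ-< (proj₂ (col-range t)) (proj₁ (col-range t)))
    eρ : ∀ s → 2 ℕ.+ toℕ (ρF s) ≡ ρ s
    eρ s = P.trans (P.cong (2 ℕ.+_) (FinP.toℕ-fromℕ< _)) (ℕ.m+[n∸m]≡n (proj₁ (ρ-range s)))
    eγ : ∀ t → k ℕ.+ toℕ (γF t) ≡ γ t
    eγ t = P.trans (P.cong (k ℕ.+_) (FinP.toℕ-fromℕ< _)) (ℕ.m+[n∸m]≡n (proj₁ (col-range t)))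
    smF : StrictMono ρF
    smF x y lt = P.subst₂ ℕ._<_ (P.sym (FinP.toℕ-fromℕ< _)) (P.sym (FinP.toℕ-fromℕ< _)) (ℕ.∸-monoˡ-< (ρ-inc x y lt) (proj₁ (ρ-range x)))
    smG : StrictMono γF
    smG x y lt = P.subst₂ ℕ._<_ (P.sym (FinP.toℕ-fromℕ< _)) (P.sym (FinP.toℕ-fromℕ< _)) (ℕ.∸-monoˡ-< (γ-inc x y lt) (proj₁ (col-range x)))

  entry-diag : ∀ i b → b ℕ.< k → b ≡ i ∸ 1 → entry i b ≈ 1#
  entry-diag i b lt eq with b ℕ.<ᵇ k in e
  ... | false = ⊥-elim (P.subst T e (ℕ.<⇒<ᵇ lt))
  ... | true with b ℕ.≡ᵇ (i ∸ 1) in e2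
  ...   | true = refl
  ...   | false = ⊥-elim (P.subst T e2 (ℕ.≡⇒≡ᵇ b (i ∸ 1) eq))

  entry-offDiag : ∀ i b → b ℕ.< k → b ≢ i ∸ 1 → entry i b ≈ 0#
  entry-offDiag i b lt ne with b ℕ.<ᵇ k in e
  ... | false = ⊥-elim (P.subst T e (ℕ.<⇒<ᵇ lt))
  ... | true with b ℕ.≡ᵇ (i ∸ 1) in e2
  ...   | true = ⊥-elim (ne (ℕ.≡ᵇ⇒≡ b (i ∸ 1) (P.subst T (P.sym e2) tt)))
  ...   | false = refl

  extraDegree-unit : ∀ i b → b ℕ.< k → extraDegree i b ≡ 0
  extraDegree-unit i b lt with b ℕ.<ᵇ k in e
  ... | false = ⊥-elim (P.subst T e (ℕ.<⇒<ᵇ lt))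
  ... | true = P.refl

  window-< : ∀ r (ρ τ es : Fin r → ℕ) W → (∀ l → suc (τ l) ℕ.≤ ρ l ℕ.+ W) → sumℕ r es ℕ.+ r ℕ.* W ℕ.< m →
          (sumℕ r es ℕ.+ sumℕ r (suc ∘ τ)) ∸ sumℕ r ρ ℕ.< m
  window-< r ρ τ es W h lt = ℕ.≤-<-trans (ℕ.m≤n+o⇒m∸n≤o _ (sumℕ r ρ) le) lt
    where
    le : sumℕ r es ℕ.+ sumℕ r (suc ∘ τ) ℕ.≤ sumℕ r ρ ℕ.+ (sumℕ r es ℕ.+ r ℕ.* W)
    le = ℕ.≤-trans (ℕ.+-monoʳ-≤ (sumℕ r es) (ℕ.≤-trans (sumℕ-mono-≤ r _ _ h) (ℕ.≤-reflexive (sumℕ-+-const r ρ W))))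
           (ℕ.≤-reflexive (e (sumℕ r es) (sumℕ r ρ) (r ℕ.* W)))
      where e : ∀ a b c → a ℕ.+ (b ℕ.+ c) ≡ b ℕ.+ (a ℕ.+ c)
            e = solve-∀

  k[n∸k]+2≤m : k ℕ.* (n ∸ k) ℕ.+ 2 ℕ.≤ m
  k[n∸k]+2≤m = P.subst (λ z → z ℕ.+ 2 ℕ.≤ m) (P.sym (ℕ.*-distribˡ-∸ k n k)) bnd

  module _ (u : Fin k → Carrier) where
    codeword : ℕ → Carrier
    codeword b = sumF k (λ s → u s * entry (suc (toℕ s)) b)

    open PrefixSpan F K ι hom codeword public

    rank≥-nonRedundant : (σ : Fin δ → ℕ) → Increasing σ → (∀ t → σ t ℕ.< n) → (∀ t → ¬ Redundant (σ t)) →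
             RankAtLeast F (Ψ B (vecMat K u G)) δ
    rank≥-nonRedundant σ sm b nr = σF , inj , ind
      where
      σF : Fin δ → Fin n
      σF t = Fin.fromℕ< (b t)
      eσ : ∀ t → toℕ (σF t) ≡ σ t
      eσ t = FinP.toℕ-fromℕ< (b t)
      inj : ∀ s t → σF s ≡ σF t → s ≡ t
      inj s t e = increasing-injective sm s t (P.trans (P.sym (eσ s)) (P.trans (P.cong toℕ e) (eσ t)))
      ind : ∀ (cs : Fin δ → F.Carrier) → (∀ i → FO.sumF δ (λ t → cs t F.* Ψ B (vecMat K u G) i (σF t)) F.≈ F.0#) → ∀ t → cs t F.≈ F.0#
      ind cs h = nonRedundant-independent _≈?_ δ σ sm nr cs z
        where
        co : Fin δ → Fin m → F.Carrier
        co t i = coord (codeword (toℕ (σF t))) i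
        z : sumF δ (λ t → ι (cs t) * codeword (σ t)) ≈ 0#
        z = begin
          sumF δ (λ t → ι (cs t) * codeword (σ t))
            ≈⟨ sumF-cong δ (λ t → *-congˡ (trans (reflexive (P.cong codeword (P.sym (eσ t)))) (expand _))) ⟩
          sumF δ (λ t → ι (cs t) * sumF m (λ i → ι (co t i) * pow β (toℕ i)))
            ≈⟨ sumF-cong δ (λ t → trans (*-distribˡ-sumF m _ _) (sumF-cong m (λ i → trans (sym (*-assoc _ _ _)) (*-congʳ (sym (ι-* _ _)))))) ⟩
          sumF δ (λ t → sumF m (λ i → ι (cs t F.* co t i) * pow β (toℕ i)))
            ≈⟨ sumF-comm δ m _ ⟩
          sumF m (λ i → sumF δ (λ t → ι (cs t F.* co t i) * pow β (toℕ i)))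
            ≈⟨ sumF-cong m (λ i → trans (sumF-cong δ (λ t → *-comm _ _)) (trans (sym (*-distribˡ-sumF δ _ _)) (trans (*-comm _ _) (*-congʳ (sym (ι-sumF δ _)))))) ⟩
          sumF m (λ i → ι (FO.sumF δ (λ t → cs t F.* co t i)) * pow β (toℕ i))
            ≈⟨ sumF-zero m (λ i → *≈0ˡ (trans (ι-cong (h i)) ι-0)) ⟩
          0# ∎

    window-column : ∀ A L → A ℕ.+ k ℕ.≤ n ℕ.+ L → suc A ℕ.≤ suc L ℕ.+ (n ∸ k)
    window-column A L h = s≤s (ℕ.+-cancelʳ-≤ k A (L ℕ.+ (n ∸ k)) (ℕ.≤-trans h (ℕ.≤-reflexive (e1))))
      where
      e1 : n ℕ.+ L ≡ L ℕ.+ (n ∸ k) ℕ.+ k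
      e1 = P.trans (P.cong (ℕ._+ L) (P.sym (ℕ.m∸n+n≡m k≤n))) (e2 (n ∸ k) k L)
        where e2 : ∀ x y z → x ℕ.+ y ℕ.+ z ≡ z ℕ.+ x ℕ.+ y
              e2 = solve-∀

    module ManyRedundant (u≉0 : ∃ (λ s → ¬ (u s ≈ 0#))) (A1 : A1MinorsNonzero F n k a) (A2 : A2MinorsNonzero F n k a)
                   (a≉0 : A-nonzero)
                   (τ : Fin (suc (n ∸ δ)) → ℕ) (τ-inc : Increasing τ) (τ<n : ∀ l → τ l ℕ.< n) (τ-red : ∀ l → Redundant (τ l)) where
      k′ : ℕ
      k′ = n ∸ δ
      k≡1+k′ : k ≡ suc k′
      k≡1+k′ = ℕ.+-comm (n ∸ δ) 1
      u′ : Fin (suc k′) → Carrier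
      u′ s = u (Fin.cast (P.sym k≡1+k′) s)
      codeword′ : ℕ → Carrier
      codeword′ b = sumF (suc k′) (λ s → u′ s * entry (suc (toℕ s)) b)
      codeword≈codeword′ : ∀ b → codeword b ≈ codeword′ b
      codeword≈codeword′ b = trans (sumF-cast k≡1+k′ (λ s → u s * entry (suc (toℕ s)) b))
                (sumF-cong (suc k′) {λ s → u (Fin.cast (P.sym k≡1+k′) s) * entry (suc (toℕ (Fin.cast (P.sym k≡1+k′) s))) b} {λ s → u′ s * entry (suc (toℕ s)) b}
                  (λ s → *-congˡ (reflexive (P.cong (λ z → entry (suc z) b) (FinP.toℕ-cast (P.sym k≡1+k′) s)))))
      u′≉0 : ∃ (λ s → ¬ (u′ s ≈ 0#))
      u′≉0 = Fin.cast k≡1+k′ (proj₁ u≉0) , (λ z → proj₂ u≉0 (trans (reflexive (P.cong u (P.sym (FinP.cast-involutive (P.sym k≡1+k′) k≡1+k′ (proj₁ u≉0))))) z))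
      coeff : ∀ l → Fin (τ l) → F.Carrier
      coeff l = proj₁ (τ-red l)
      τ-reduced : ∀ l → codeword′ (τ l) ≈ sumF (τ l) (λ b → ι (coeff l b) * codeword′ (toℕ b))
      τ-reduced l = trans (sym (codeword≈codeword′ _)) (trans (proj₂ (τ-red l)) (sumF-cong (τ l) (λ b → *-congˡ (codeword≈codeword′ _))))
      W : ℕ
      W = n ∸ k
      2+s≤k : ∀ (s : Fin k′) → suc (suc (toℕ s)) ℕ.≤ k
      2+s≤k s = P.subst (suc (suc (toℕ s)) ℕ.≤_) (P.sym k≡1+k′) (s≤s (FinP.toℕ<n s))
      1+s≤k : ∀ (s : Fin (suc k′)) → suc (toℕ s) ℕ.≤ k
      1+s≤k s = P.subst (suc (toℕ s) ℕ.≤_) (P.sym k≡1+k′) (FinP.toℕ<n s)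
      k′W≤kW : k′ ℕ.* W ℕ.≤ k ℕ.* W
      k′W≤kW = ℕ.*-monoˡ-≤ W (P.subst (k′ ℕ.≤_) (P.sym k≡1+k′) (ℕ.n≤1+n k′))
      kW<m : k ℕ.* W ℕ.< m
      kW<m = ℕ.≤-trans (ℕ.≤-trans (ℕ.n≤1+n _) (ℕ.≤-reflexive (ℕ.+-comm 2 (k ℕ.* W)))) k[n∸k]+2≤m
      leading-reduced : ∀ i l e t → 1 ℕ.≤ i → i ℕ.≤ k → Leading (pow β i * entry i (τ l)) i (suc (τ l) ℕ.+ e) t →
             Leading (pow β i * reducedEntry i (τ l) (coeff l)) i (suc (τ l) ℕ.+ e) t
      leading-reduced i l e t a1 a2 hq = leading-reducedEntry i (τ l) (coeff l) e t a1 a2 (τ<n l) hq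
      leading-entry-lower : ∀ i l → 2 ℕ.≤ i → i ℕ.≤ k → Leading (pow β i * entry i (τ l)) i (suc (τ l) ℕ.+ 0) (topCoeff i (τ l))
      leading-entry-lower i l a1 a2 = leading-≡ P.refl (P.cong (suc (τ l) ℕ.+_) (extraDegree-notFirst i (τ l) (λ e → ℕ.<-irrefl (P.sym e) a1)))
                         (leading-entry i (τ l) (ℕ.<⇒≤ a1) a2 (τ<n l))

      τ-suc-positive : ∀ l → 1 ℕ.≤ τ (Fin.suc l)
      τ-suc-positive l = ℕ.≤-trans (s≤s z≤n) (τ-inc Fin.zero (Fin.suc l) (s≤s z≤n))

      absurd-u₁≈0 : u′ Fin.zero ≈ 0# → ⊥
      absurd-u₁≈0 u₁≈0 = reducedMatrix-contradiction k′ ρC τC esC xC v TmC nzv relC entC widC detC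
        where
        ρC τC esC : Fin k′ → ℕ
        ρC s = suc (suc (toℕ s))
        τC l = τ (Fin.suc l)
        esC _ = 0
        xC : ∀ l → Fin (τC l) → F.Carrier
        xC l = coeff (Fin.suc l)
        v : Fin k′ → Carrier
        v s = u′ (Fin.suc s)
        TmC : Fin k′ → Fin k′ → F.Carrier
        TmC s l = topCoeff (ρC s) (τC l)
        nzv : ∃ (λ s → ¬ (v s ≈ 0#))
        nzv with u′≉0
        ... | (Fin.zero , p) = ⊥-elim (p u₁≈0)
        ... | (Fin.suc s , p) = s , p
        Cs≈ : ∀ b → codeword′ b ≈ sumF k′ (λ s → v s * entry (ρC s) b)
        Cs≈ b = trans (+-congʳ (*≈0ˡ u₁≈0)) (+-identityˡ _)
        relC : ∀ l → sumF k′ (λ s → v s * entry (ρC s) (τC l)) ≈ sumF (τC l) (λ b → ι (xC l b) * sumF k′ (λ s → v s * entry (ρC s) (toℕ b)))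
        relC l = trans (sym (Cs≈ _)) (trans (τ-reduced (Fin.suc l)) (sumF-cong (τC l) (λ b → *-congˡ (Cs≈ _))))
        entC : ∀ s l → Leading (pow β (ρC s) * reducedEntry (ρC s) (τC l) (xC l)) (ρC s) (suc (τC l) ℕ.+ esC s) (TmC s l)
        entC s l = leading-reduced (ρC s) (Fin.suc l) 0 _ (s≤s z≤n) (2+s≤k s) (leading-entry-lower (ρC s) (Fin.suc l) (s≤s (s≤s z≤n)) (2+s≤k s))
        widC : (sumℕ k′ esC ℕ.+ sumℕ k′ (suc ∘ τC)) ∸ sumℕ k′ ρC ℕ.< m
        widC = window-< k′ ρC τC esC W
                 (λ l → window-column (τC l) (suc (toℕ l)) (P.subst (λ z → τC l ℕ.+ z ℕ.≤ n ℕ.+ suc (toℕ l)) (P.sym k≡1+k′) (increasing-bound n (suc k′) τ τ-inc τ<n (Fin.suc l))))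
                 (ℕ.≤-<-trans (ℕ.≤-reflexive (P.cong (ℕ._+ k′ ℕ.* W) (sumℕ-zero k′))) (ℕ.≤-<-trans k′W≤kW kW<m))
        detC : ¬ (FO.det k′ TmC F.≈ F.0#)
        detC = topCoeffDet-nonzero 2 n (s≤s z≤n) (A2-minorsNonzero A2) k′ ρC τC TmC
                 (λ x y lt → s≤s (s≤s lt)) (increasing-suc τ-inc) (λ s → s≤s (s≤s z≤n) , 2+s≤k s) (λ l _ → τ<n (Fin.suc l)) unC (λ s l → F.refl)
          where
          unC : ∀ l → τC l ℕ.< k → ∃ (λ s → ρC s ≡ suc (τC l))
          unC l lt = Fin.fromℕ< lt' , P.trans (P.cong (suc ∘ suc) (FinP.toℕ-fromℕ< lt')) (P.cong suc (ℕ.suc-pred (τC l) {{ℕ.>-nonZero (τ-suc-positive l)}}))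
            where
            lt' : τC l ∸ 1 ℕ.< k′
            lt' = ℕ.∸-monoˡ-< (P.subst (τC l ℕ.<_) k≡1+k′ lt) (τ-suc-positive l)

      0<k : 0 ℕ.< k
      0<k = P.subst (0 ℕ.<_) (P.sym k≡1+k′) (s≤s z≤n)
      1≤k : 1 ℕ.≤ k
      1≤k = 0<k

      codeword′-zero : codeword′ 0 ≈ u′ Fin.zero
      codeword′-zero = trans (+-cong (*-congˡ (entry-diag 1 0 0<k P.refl)) (sumF-zero k′ (λ s → *≈0ʳ (entry-offDiag (suc (suc (toℕ s))) 0 0<k (λ ())))))
                   (trans (+-identityʳ _) (*-identityʳ _))

      τ-positive : ¬ (u′ Fin.zero ≈ 0#) → ∀ l → 1 ℕ.≤ τ l
      τ-positive u₁≉0 l with τ l in eq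
      ... | suc _ = s≤s z≤n
      ... | zero with P.subst Redundant eq (τ-red l)
      ...   | (x , e) = ⊥-elim (u₁≉0 (trans (sym codeword′-zero) (trans (sym (codeword≈codeword′ 0)) e)))

      last : Fin (suc k′)
      last = Fin.fromℕ k′

      τ≤last : ∀ l → τ l ℕ.≤ τ last
      τ≤last l with toℕ l ℕ.<? k′
      ... | yes lt = ℕ.<⇒≤ (τ-inc l last (P.subst (toℕ l ℕ.<_) (P.sym (FinP.toℕ-fromℕ k′)) lt))
      ... | no nlt = ℕ.≤-reflexive (P.cong τ (FinP.toℕ-injective (P.trans (ℕ.≤-antisym (FinP.toℕ≤pred[n] l) (ℕ.≮⇒≥ nlt)) (P.sym (FinP.toℕ-fromℕ k′)))))

      τ<last : ∀ l → l ≢ last → τ l ℕ.< τ last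
      τ<last l ne with toℕ l ℕ.<? k′
      ... | yes lt = τ-inc l last (P.subst (toℕ l ℕ.<_) (P.sym (FinP.toℕ-fromℕ k′)) lt)
      ... | no nlt = ⊥-elim (ne (FinP.toℕ-injective (P.trans (ℕ.≤-antisym (FinP.toℕ≤pred[n] l) (ℕ.≮⇒≥ nlt)) (P.sym (FinP.toℕ-fromℕ k′)))))

      ρB : Fin (suc k′) → ℕ
      ρB s = suc (toℕ s)

      window-columnB : ∀ l → suc (τ l) ℕ.≤ ρB l ℕ.+ W
      window-columnB l = window-column (τ l) (toℕ l) (P.subst (λ z → τ l ℕ.+ z ℕ.≤ n ℕ.+ toℕ l) (P.sym k≡1+k′) (increasing-bound n (suc k′) τ τ-inc τ<n l))

      k′W≡kW : suc k′ ℕ.* W ≡ k ℕ.* W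
      k′W≡kW = P.cong (ℕ._* W) (P.sym k≡1+k′)

      absurd-interior : ¬ (u′ Fin.zero ≈ 0#) → ¬ ((k ℕ.≤ τ last) × (suc (τ last) ≡ n)) → ⊥
      absurd-interior u₁≉0 notCorner = reducedMatrix-contradiction (suc k′) ρB τ esB coeff u′ TmB u′≉0 τ-reduced entB widB detB
        where
        esB : Fin (suc k′) → ℕ
        esB _ = 0
        TmB : Fin (suc k′) → Fin (suc k′) → F.Carrier
        TmB s l = topCoeff (ρB s) (τ l)
        below-last : ∀ l → k ℕ.≤ τ l → suc (τ l) ℕ.< n
        below-last l k≤τl with suc (τ l) ℕ.<? n
        ... | yes lt = lt
        ... | no nlt = ⊥-elim (notCorner (ℕ.≤-trans k≤τl (τ≤last l) , ℕ.≤-antisym (τ<n last) (ℕ.≤-trans (ℕ.≮⇒≥ nlt) (s≤s (τ≤last l)))))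
        extraDegreeB-zero : ∀ s l → extraDegree (ρB s) (τ l) ≡ 0
        extraDegreeB-zero s l with τ l ℕ.<? k
        ... | yes lt = extraDegree-unit (ρB s) (τ l) lt
        ... | no nlt = extraDegree-notLast (ρB s) (τ l) (below-last l (ℕ.≮⇒≥ nlt))
        entB : ∀ s l → Leading (pow β (ρB s) * reducedEntry (ρB s) (τ l) (coeff l)) (ρB s) (suc (τ l) ℕ.+ esB s) (TmB s l)
        entB s l = leading-reduced (ρB s) l 0 _ (s≤s z≤n) (1+s≤k s)
                     (leading-≡ P.refl (P.cong (suc (τ l) ℕ.+_) (extraDegreeB-zero s l)) (leading-entry (ρB s) (τ l) (s≤s z≤n) (1+s≤k s) (τ<n l)))
        widB : (sumℕ (suc k′) esB ℕ.+ sumℕ (suc k′) (suc ∘ τ)) ∸ sumℕ (suc k′) ρB ℕ.< m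
        widB = window-< (suc k′) ρB τ esB W window-columnB
                 (ℕ.≤-<-trans (ℕ.≤-reflexive (P.trans (P.cong (ℕ._+ suc k′ ℕ.* W) (sumℕ-zero (suc k′))) k′W≡kW)) kW<m)
        detB : ¬ (FO.det (suc k′) TmB F.≈ F.0#)
        detB = topCoeffDet-nonzero 1 (n ∸ 1) (s≤s z≤n) (A1-minorsNonzero A1) (suc k′) ρB τ TmB (λ x y lt → s≤s lt) τ-inc
                 (λ s → s≤s z≤n , 1+s≤k s) (λ l k≤τl → ℕ.∸-monoˡ-< (below-last l k≤τl) (s≤s z≤n))
                 (λ l lt → Fin.fromℕ< (P.subst (τ l ℕ.<_) k≡1+k′ lt) , P.cong suc (FinP.toℕ-fromℕ< _)) (λ _ _ → F.refl)

      -- Only the β^n entry lifts the first row one degree higher, so in the corner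
      -- case that row of top coefficients is a_{1,n-1} times a unit vector.
      firstRowTop : ∀ l → Dec (suc (τ l) ℕ.< n) → F.Carrier
      firstRowTop l (yes _) = F.0#
      firstRowTop l (no _) = a 1 (τ l)

      absurd-corner : ¬ (u′ Fin.zero ≈ 0#) → (k ℕ.≤ τ last) × (suc (τ last) ≡ n) → ⊥
      absurd-corner u₁≉0 (k≤τₖ , τₖ+1≡n) = reducedMatrix-contradiction (suc k′) ρB τ esA coeff u′ TmA u′≉0 τ-reduced entA widA detA
        where
        esA : Fin (suc k′) → ℕ
        esA Fin.zero = 1
        esA (Fin.suc _) = 0
        TmA : Fin (suc k′) → Fin (suc k′) → F.Carrier
        TmA Fin.zero l = firstRowTop l (suc (τ l) ℕ.<? n)
        TmA (Fin.suc s) l = topCoeff (suc (suc (toℕ s))) (τ l)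
        leading-firstRow : ∀ l d → Leading (pow β 1 * entry 1 (τ l)) 1 (suc (τ l) ℕ.+ 1) (firstRowTop l d)
        leading-firstRow l (yes lt) = leading-lift (suc (τ l) ℕ.+ 1) (ℕ.+-monoʳ-< (suc (τ l)) (s≤s z≤n))
                          (leading-≡ P.refl (P.cong (suc (τ l) ℕ.+_) (extraDegree-notLast 1 (τ l) lt)) (leading-entry 1 (τ l) (s≤s z≤n) 1≤k (τ<n l)))
        leading-firstRow l (no nlt) = leading-≡ P.refl (P.cong (suc (τ l) ℕ.+_) (extraDegree-corner (τ l) kτl sτn))
                          (leading-cong (leading-entry 1 (τ l) (s≤s z≤n) 1≤k (τ<n l)) refl (topCoeff-A 1 (τ l) kτl))
          where
          sτn : suc (τ l) ≡ n
          sτn = ℕ.≤-antisym (τ<n l) (ℕ.≮⇒≥ nlt)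
          kτl : k ℕ.≤ τ l
          kτl = P.subst (k ℕ.≤_) (ℕ.suc-injective (P.trans τₖ+1≡n (P.sym sτn))) k≤τₖ
        entA : ∀ s l → Leading (pow β (ρB s) * reducedEntry (ρB s) (τ l) (coeff l)) (ρB s) (suc (τ l) ℕ.+ esA s) (TmA s l)
        entA Fin.zero l = leading-reduced 1 l 1 _ (s≤s z≤n) 1≤k (leading-firstRow l (suc (τ l) ℕ.<? n))
        entA (Fin.suc s) l = leading-reduced (suc (suc (toℕ s))) l 0 _ (s≤s z≤n) (2+s≤k s) (leading-entry-lower _ l (s≤s (s≤s z≤n)) (2+s≤k s))
        widA : (sumℕ (suc k′) esA ℕ.+ sumℕ (suc k′) (suc ∘ τ)) ∸ sumℕ (suc k′) ρB ℕ.< m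
        widA = window-< (suc k′) ρB τ esA W window-columnB
                 (ℕ.<-≤-trans (ℕ.≤-reflexive (P.cong suc (P.trans (P.cong (λ z → suc z ℕ.+ suc k′ ℕ.* W) (sumℕ-zero k′)) (P.cong suc k′W≡kW))))
                   (ℕ.≤-trans (ℕ.≤-reflexive (ℕ.+-comm 2 (k ℕ.* W))) k[n∸k]+2≤m))
        firstRowTop-notLast : ∀ j d → j ≢ last → firstRowTop j d F.≈ F.0#
        firstRowTop-notLast j (yes _) ne = F.refl
        firstRowTop-notLast j (no nlt) ne = ⊥-elim (nlt (ℕ.<-≤-trans (s≤s (τ<last j ne)) (τ<n last)))
        firstRowTop-last : ∀ d → firstRowTop last d F.≈ a 1 (τ last)
        firstRowTop-last (yes lt) = ⊥-elim (ℕ.<-irrefl τₖ+1≡n lt)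
        firstRowTop-last (no _) = F.refl
        ρ' τ' : Fin k′ → ℕ
        ρ' s = suc (suc (toℕ s))
        τ' t = τ (punchIn last t)
        minor-nonzero : ¬ (FO.det k′ (FD.minor TmA last) F.≈ F.0#)
        minor-nonzero = topCoeffDet-nonzero 2 n (s≤s z≤n) (A2-minorsNonzero A2) k′ ρ' τ' (FD.minor TmA last)
                 (λ x y lt → s≤s (s≤s lt)) (increasing-punchIn last τ-inc) (λ s → s≤s (s≤s z≤n) , 2+s≤k s) (λ t _ → τ<n (punchIn last t)) un' (λ _ _ → F.refl)
          where
          un' : ∀ t → τ' t ℕ.< k → ∃ (λ s → ρ' s ≡ suc (τ' t))
          un' t lt = Fin.fromℕ< lt' , P.trans (P.cong (suc ∘ suc) (FinP.toℕ-fromℕ< lt')) (P.cong suc (ℕ.suc-pred (τ' t) {{ℕ.>-nonZero (τ-positive u₁≉0 (punchIn last t))}}))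
            where
            lt' : τ' t ∸ 1 ℕ.< k′
            lt' = ℕ.∸-monoˡ-< (P.subst (τ' t ℕ.<_) k≡1+k′ lt) (τ-positive u₁≉0 (punchIn last t))
        a₁≉0 : ¬ (a 1 (τ last) F.≈ F.0#)
        a₁≉0 = a≉0 1 (τ last) (s≤s z≤n) 1≤k k≤τₖ (ℕ.≤-reflexive (P.cong ℕ.pred τₖ+1≡n))
        detA : ¬ (FO.det (suc k′) TmA F.≈ F.0#)
        detA d = FS.*-nonzero a₁≉0 minor-nonzero (F.trans (F.*-congʳ (F.sym (firstRowTop-last (suc (τ last) ℕ.<? n))))
                   (FS.alt-zero⁻¹ (toℕ last) (F.trans (F.sym (FS.sumF-single (suc k′) (λ j → FO.alt (toℕ j) (TmA Fin.zero j F.* FO.det k′ (FD.minor TmA j))) last (λ j ne → FS.alt-zero (toℕ j) (FS.*≈0ˡ (firstRowTop-notLast j (suc (τ j) ℕ.<? n) ne))))) d)))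

      absurd : ⊥
      absurd with u′ Fin.zero ≟K 0#
      ... | yes u₁≈0 = absurd-u₁≈0 u₁≈0
      ... | no u₁≉0 with k ℕ.≤? τ last | suc (τ last) ℕ.≟ n
      ...   | yes p | yes q = absurd-corner u₁≉0 (p , q)
      ...   | no np | _ = absurd-interior u₁≉0 (λ pq → np (proj₁ pq))
      ...   | _ | no nq = absurd-interior u₁≉0 (λ pq → nq (proj₂ pq))

  systematic : IsSystematic K G
  systematic = (λ i j j≡i → entry-diag (suc (toℕ i)) (toℕ j) (P.subst (ℕ._< k) (P.sym j≡i) (FinP.toℕ<n i)) j≡i) ,
               (λ i j j<k j≢i → entry-offDiag (suc (toℕ i)) (toℕ j) j<k j≢i)

  vecMat-unitColumn : ∀ (u : Fin k → Carrier) (i : Fin k) (j : Fin n) → toℕ j ≡ toℕ i → vecMat K u G j ≈ u i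
  vecMat-unitColumn u i j j≡i = trans
    (sumF-single k _ i (λ s s≢i → *≈0ʳ (entry-offDiag (suc (toℕ s)) (toℕ j) j<k (λ j≡s → s≢i (FinP.toℕ-injective (P.trans (P.sym j≡s) j≡i))))))
    (trans (*-congˡ (entry-diag (suc (toℕ i)) (toℕ j) j<k j≡i)) (*-identityʳ _))
    where
    j<k : toℕ j ℕ.< k
    j<k = P.subst (ℕ._< k) (P.sym j≡i) (FinP.toℕ<n i)

  fullRank : ∀ (u : Fin k → Carrier) → (∀ j → vecMat K u G j ≈ 0#) → ∀ i → u i ≈ 0#
  fullRank u uG≈0 i = trans (sym (vecMat-unitColumn u i j (FinP.toℕ-fromℕ< _))) (uG≈0 j)
    where
    j : Fin n
    j = Fin.fromℕ< (ℕ.<-≤-trans (FinP.toℕ<n i) k≤n)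

  minRank : A1MinorsNonzero F n k a → A2MinorsNonzero F n k a → A-nonzero →
            ∀ (u : Fin k → Carrier) → ¬ (∀ j → vecMat K u G j ≈ 0#) → RankAtLeast F (Ψ B (vecMat K u G)) δ
  minRank A1 A2 a≉0 u uG≉0
    with pigeonhole n (Redundant u) (redundant? u FF _≟K_) (suc (n ∸ δ)) δ (P.cong suc (ℕ.m∸n+n≡m δ≤n))
  ... | inj₁ (τ , τ-inc , τ<n , τ-red) = ⊥-elim (ManyRedundant.absurd u u≉0 A1 A2 a≉0 τ τ-inc τ<n τ-red)
    where
    u≉0 : ∃ (λ s → ¬ (u s ≈ 0#))
    u≉0 = FinP.¬∀⟶∃¬ k (λ s → u s ≈ 0#) (λ s → u s ≟K 0#) (λ u≈0 → uG≉0 (λ j → sumF-zero k (λ s → *≈0ˡ (u≈0 s))))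
  ... | inj₂ (σ , σ-inc , σ<n , σ-nonRed) = rank≥-nonRedundant u σ σ-inc σ<n σ-nonRed


open import Data.Nat using (_+_; _*_; _≤_)

lemma3p3 : ∀ {c ℓ c' ℓ' : Level} (F : Field c ℓ) (K : Field c' ℓ')
    (q m n δ : ℕ) → PrimePower q → FiniteField F q →
    (ι : Field.Carrier F → Field.Carrier K) → IsFieldHom F K ι →
    (β : Field.Carrier K) → (B : PowerBasis F K ι m β) →
    1 ≤ δ → δ ≤ n → n ≤ m →
    kOf n δ * n ∸ kOf n δ * kOf n δ + 2 ≤ m →
    (a : ℕ → ℕ → Field.Carrier F) →
    (∀ i j → 1 ≤ i → i ≤ kOf n δ → kOf n δ ≤ j → j ≤ n ∸ 1 →
      ¬ (Field._≈_ F (a i j) (Field.0# F))) →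
    A1MinorsNonzero F n (kOf n δ) a →
    A2MinorsNonzero F n (kOf n δ) a →
    IsSystematic K (gMatrix F K ι β n (kOf n δ) a) ×
    IsMRDGenerator B n δ (kOf n δ) (gMatrix F K ι β n (kOf n δ) a)
lemma3p3 F K q m n δ _ FF ι hom β B δ≥1 δ≤n _ bound a a≉0 A1 A2 =
  systematic , record { k≡ = P.refl ; fullRank = fullRank ; minRank = minRank A1 A2 a≉0 }
  where open Lemma33 F K n δ FF ι hom β B δ≥1 δ≤n bound a
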